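{- Let $q$ be a power of an odd prime, let $n$ be an odd positive integer, and let $a,c\in\mathbb{F}_q$. Let $f:\mathbb{F}_{q^2}\to\mathbb{F}_{q^2}$ be given by $f(X)=(cX^q+aX)(X^q-X)^{n-1}$, and put $\delta_1=a+c$ and $\delta_2=a-c$. Assume $\delta_2\neq0$. Let $\alpha\in\mathbb{F}_{q^2}$ be nonzero and let $f^{ -1}(\alpha)=\{x\in\mathbb{F}_{q^2}: f(x)=\alpha\}$. If $\delta_1=0$, then $\#f^{ -1}(\alpha)\in\{0,\ q\cdot\gcd(n,q-1)\}$. If $\delta_1\neq0$, then $\#f^{ -1}(\alpha)\in\{0,\ \gcd(n,q-1)\}$. -}

module Defs where

open import Level using (Level; _⊔_) renaming (suc to lsuc)
open import Data.Nat using (ℕ)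
open import Data.Fin using (Fin)
open import Data.List using (List; length; filter)
open import Data.Product using (∃)
open import Relation.Nullary using (¬_)
open import Relation.Binary using (Decidable)
open import Relation.Binary.PropositionalEquality using (_≡_)
open import Algebra.Bundles using (CommutativeRing)
import Algebra.Bundles
import Algebra.Definitions.RawSemiring as RawSemiringDefs
import Data.Fin.Base as FinB
import Data.List.Base as ListB

record FiniteField (c ℓ : Level) : Set (lsuc (c ⊔ ℓ)) where
  field
    commRing : CommutativeRing c ℓ
  open CommutativeRing commRing public
  field
    1≉0       : ¬ (1# ≈ 0#)
    inverse   : ∀ x → ¬ (x ≈ 0#) → ∃ λ y → x * y ≈ 1#
    _≟_       : Decidable _≈_
    size      : ℕ
    enum      : Fin size → Carrier
    enum-inj  : ∀ i j → enum i ≈ enum j → i ≡ j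
    enum-surj : ∀ x → ∃ λ i → enum i ≈ x

  open RawSemiringDefs (Algebra.Bundles.Semiring.rawSemiring semiring) public using (_^_)

  fiberCount : (Carrier → Carrier) → Carrier → ℕ
  fiberCount g α = length (filter (λ i → g (enum i) ≟ α) (ListB.allFin size))

module _ {c ℓ : Level} (K : FiniteField c ℓ) where
  open FiniteField K

  -- x lies in the subfield {x : x^q = x} (= F_q when |K| = q²)
  InSubfield : ℕ → Carrier → Set ℓ
  InSubfield q x = (x ^ q) ≈ x

  paperMap : (q n : ℕ) (a c : Carrier) → Carrier → Carrier
  paperMap q n a c X = ((c * (X ^ q)) + (a * X)) * (((X ^ q) - X) ^ (n ∸ 1))
    where open import Data.Nat using (_∸_)

-- Since q is odd, K = F ⊕ V with F = {x : x^q = x} = F_q and V = {v : v^q = -v}, via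
-- x = (x + x^q)/2 + (x - x^q)/2.  For x = s + v with s ∈ F and v ∈ V we have x^q - x = -2v, so
-- f(s + v) = (δ₁ s + δ₂ v)(2v)^(n-1) = δ₁ s (2v)^(n-1) + κ v^n with κ = δ₂ 2^(n-1), and the two
-- summands are the F- and V-components of f(s + v).  If δ₁ = 0 the fibre over α is
-- F × {v ∈ V : κ v^n = α}.  If δ₁ ≠ 0, s is determined by v, and the fibre is in bijection with
-- {v ∈ V : κ v^n = α_V, (2v)^(n-1) ≠ 0}, where α_V is the V-component of α.  Finally, for β ≠ 0 the
-- solutions v ∈ V of κ v^n = β are either none or a coset v₀ μ_g of the g-th roots of unity,
-- g = gcd(n, q - 1); these lie in F^× and there are exactly g of them because g ∣ q - 1.
module Submission where

open import Defs
open import Algebra.Bundles using (CommutativeRing)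
open import Data.Empty using (⊥; ⊥-elim)
open import Data.Fin using (Fin)
open import Data.List using (List; []; _∷_; _++_; map; filter; length; tabulate; allFin; cartesianProductWith)
open import Data.List.Relation.Unary.All as All using (All; []; _∷_)
import Data.List.Relation.Unary.All.Properties as All
open import Data.List.Relation.Unary.AllPairs using ([]; _∷_)
open import Data.List.Relation.Unary.Any using (here; there)
open import Data.Maybe using (Maybe; just; nothing)
open import Data.Nat as ℕ using (ℕ; zero; suc; _≤_; _<_; z≤n; s≤s)
open import Data.Nat.Divisibility using (_∣_; divides)
open import Data.Nat.GCD using (gcd; gcd-GCD; gcd-zeroˡ; gcd[m,n]∣m; gcd[m,n]∣n; gcd[m,n]≢0; module Bézout)
open import Data.Nat.Primality using (Prime)
import Data.Nat.Properties as ℕ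
open import Data.Product using (_×_; _,_; proj₁; proj₂; ∃)
open import Data.Sign as Sign using (Sign)
open import Data.Sum as ⊎ using (_⊎_; inj₁; inj₂; [_,_])
open import Data.Unit using (⊤; tt)
open import Function using (_∘_; id)
open import Level using (_⊔_)
open import Relation.Binary using (Setoid; _Respects_)
open import Relation.Binary.Definitions using (tri<; tri≈; tri>)
open import Relation.Binary.PropositionalEquality as ≡ using (_≡_)
open import Relation.Nullary using (¬_; ¬?; Dec; yes; no; contradiction)
open import Relation.Nullary.Decidable using (_⊎-dec_; _×-dec_)
open import Relation.Unary using (Pred; Decidable; _≐_)
open import Relation.Unary.Properties using (∁?)

-- The standard library's solvers for an abstract ring use its own carrier for coefficients, which
-- does not normalise; interpreting ℤ in R gives coefficients that compute.
module IntegerCoefficientSolver {c ℓ} (R : CommutativeRing c ℓ) where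
  open import Data.Integer as ℤ using (ℤ; +_; -[1+_]; _⊖_; sign; ∣_∣; _◃_)
  import Data.Integer.Properties as ℤ
  open CommutativeRing R
  open import Algebra.Properties.Ring ring using (-‿involutive; -‿distribˡ-*; -‿distribʳ-*; -0#≈0#; -‿+-comm)
  open import Algebra.Properties.Semiring.Mult.TCOptimised semiring using (1+×; ×-homo-+; ×1-homo-*) renaming (_×_ to _×′_)
  open import Algebra.Solver.Ring.AlmostCommutativeRing using (fromCommutativeRing; _-Raw-AlmostCommutative⟶_)
  open import Relation.Binary.Reasoning.Setoid setoid

  signed : Sign → Carrier → Carrier
  signed Sign.+ x = x
  signed Sign.- x = - x

  fromℤ : ℤ → Carrier
  fromℤ i = signed (sign i) (∣ i ∣ ×′ 1#)

  fromℤ-⊖ : ∀ m n → fromℤ (m ⊖ n) ≈ m ×′ 1# - n ×′ 1#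
  fromℤ-⊖ m zero = sym (trans (+-congˡ -0#≈0#) (+-identityʳ _))
  fromℤ-⊖ zero (suc n) = sym (+-identityˡ _)
  fromℤ-⊖ (suc m) (suc n) = begin
    fromℤ (suc m ⊖ suc n)          ≡⟨ ≡.cong fromℤ (ℤ.[1+m]⊖[1+n]≡m⊖n m n) ⟩
    fromℤ (m ⊖ n)                  ≈⟨ fromℤ-⊖ m n ⟩
    a - b                          ≈⟨ +-congʳ (sym (+-identityˡ a)) ⟩
    (0# + a) - b                   ≈⟨ +-congʳ (+-congʳ (sym (-‿inverseʳ 1#))) ⟩
    ((1# - 1#) + a) - b            ≈⟨ +-congʳ (+-assoc 1# (- 1#) a) ⟩
    (1# + (- 1# + a)) - b          ≈⟨ +-congʳ (+-congˡ (+-comm (- 1#) a)) ⟩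
    (1# + (a - 1#)) - b            ≈⟨ +-congʳ (sym (+-assoc 1# a (- 1#))) ⟩
    ((1# + a) - 1#) - b            ≈⟨ +-assoc (1# + a) (- 1#) (- b) ⟩
    (1# + a) + (- 1# + - b)        ≈⟨ +-congˡ (-‿+-comm 1# b) ⟩
    (1# + a) - (1# + b)            ≈⟨ sym (+-cong (1+× m 1#) (-‿cong (1+× n 1#))) ⟩
    suc m ×′ 1# - suc n ×′ 1#        ∎
    where
    a b : Carrier
    a = m ×′ 1#
    b = n ×′ 1#

  fromℤ-+ : ∀ i j → fromℤ (i ℤ.+ j) ≈ fromℤ i + fromℤ j
  fromℤ-+ -[1+ m ] -[1+ n ] = begin
    - (suc (suc (m ℕ.+ n)) ×′ 1#)      ≡⟨ ≡.cong (λ k → - (k ×′ 1#)) (≡.sym (ℕ.+-suc (suc m) n)) ⟩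
    - ((suc m ℕ.+ suc n) ×′ 1#)        ≈⟨ -‿cong (×-homo-+ 1# (suc m) (suc n)) ⟩
    - (suc m ×′ 1# + suc n ×′ 1#)       ≈⟨ sym (-‿+-comm _ _) ⟩
    - (suc m ×′ 1#) + - (suc n ×′ 1#)   ∎
  fromℤ-+ -[1+ m ] (+ n)    = trans (fromℤ-⊖ n (suc m)) (+-comm _ _)
  fromℤ-+ (+ m)    -[1+ n ] = fromℤ-⊖ m (suc n)
  fromℤ-+ (+ m)    (+ n)    = ×-homo-+ 1# m n

  fromℤ-‿ : ∀ i → fromℤ (ℤ.- i) ≈ - fromℤ i
  fromℤ-‿ -[1+ n ]     = sym (-‿involutive _)
  fromℤ-‿ (+ zero)     = sym -0#≈0#
  fromℤ-‿ (+ suc n)    = refl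

  signed-cong : ∀ s {x y} → x ≈ y → signed s x ≈ signed s y
  signed-cong Sign.+ = id
  signed-cong Sign.- = -‿cong

  signed-* : ∀ s t x y → signed (s Sign.* t) (x * y) ≈ signed s x * signed t y
  signed-* Sign.- Sign.- x y = trans (sym (-‿involutive _)) (trans (-‿cong (-‿distribˡ-* x y)) (-‿distribʳ-* (- x) y))
  signed-* Sign.- Sign.+ x y = -‿distribˡ-* x y
  signed-* Sign.+ Sign.- x y = -‿distribʳ-* x y
  signed-* Sign.+ Sign.+ x y = refl

  fromℤ-◃ : ∀ s n → fromℤ (s ◃ n) ≈ signed s (n ×′ 1#)
  fromℤ-◃ Sign.- zero    = sym -0#≈0#
  fromℤ-◃ Sign.+ zero    = refl
  fromℤ-◃ Sign.- (suc n) = refl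
  fromℤ-◃ Sign.+ (suc n) = refl

  fromℤ-* : ∀ i j → fromℤ (i ℤ.* j) ≈ fromℤ i * fromℤ j
  fromℤ-* i j = begin
    fromℤ (s ◃ ∣ i ∣ ℕ.* ∣ j ∣)                ≈⟨ fromℤ-◃ s (∣ i ∣ ℕ.* ∣ j ∣) ⟩
    signed s ((∣ i ∣ ℕ.* ∣ j ∣) ×′ 1#)         ≈⟨ signed-cong s (×1-homo-* ∣ i ∣ ∣ j ∣) ⟩
    signed s ((∣ i ∣ ×′ 1#) * (∣ j ∣ ×′ 1#))   ≈⟨ signed-* (sign i) (sign j) _ _ ⟩
    fromℤ i * fromℤ j                          ∎
    where
    s : Sign
    s = sign i Sign.* sign j

  fromℤ-homomorphism : ℤ.+-*-rawRing -Raw-AlmostCommutative⟶ fromCommutativeRing R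
  fromℤ-homomorphism = record
    { ⟦_⟧    = fromℤ
    ; +-homo = fromℤ-+
    ; *-homo = fromℤ-*
    ; -‿homo = fromℤ-‿
    ; 0-homo = refl
    ; 1-homo = refl
    }

  fromℤ-≈? : ∀ i j → Maybe (fromℤ i ≈ fromℤ j)
  fromℤ-≈? i j with i ℤ.≟ j
  ... | yes ≡.refl = just refl
  ... | no _       = nothing

  open import Algebra.Solver.Ring ℤ.+-*-rawRing (fromCommutativeRing R) fromℤ-homomorphism fromℤ-≈? public

  :0 :1 : ∀ {n} → Polynomial n
  :0 = con (+ 0)
  :1 = con (+ 1)

module UniqueLists {a ℓ} (S : Setoid a ℓ) where
  open Setoid S
  open import Data.List.Membership.Setoid S using (_∈_)
  open import Data.List.Membership.Setoid.Properties using (∈-∃++; ∈-resp-≈; ∈-map⁻; ∈-cartesianProductWith⁻)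
  open import Data.List.Relation.Unary.Unique.Setoid S using (Unique)
  open import Data.List.Relation.Unary.Unique.Setoid.Properties using (Unique[x∷xs]⇒x∉xs; ++⁺)
  open import Data.List.Relation.Binary.Pointwise using ([])
  open import Data.List.Relation.Binary.Permutation.Setoid S using (_↭_; prep; ↭-trans; ↭-sym; ↭-reflexive-≋)
  open import Data.List.Relation.Binary.Permutation.Setoid.Properties S using (shift; ∈-resp-↭; Unique-resp-↭)

  ↭-unique : ∀ {xs ys} → Unique xs → Unique ys →
             (∀ {z} → z ∈ xs → z ∈ ys) → (∀ {z} → z ∈ ys → z ∈ xs) → xs ↭ ys
  ↭-unique {[]}    {[]}     _ _ _ _     = ↭-reflexive-≋ []
  ↭-unique {[]}    {y ∷ ys} _ _ _ ys⊆xs with () ← ys⊆xs (here refl)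
  ↭-unique {x ∷ xs} {ys} x∷xs!@(_ ∷ xs!) ys! xs⊆ys ys⊆xs
    with hs , ts , w , x≈w , ys≋ ← ∈-∃++ S (xs⊆ys (here refl)) =
    ↭-trans (prep x≈w (↭-unique xs! ys′! xs⊆ys′ ys′⊆xs)) (↭-sym ys↭)
    where
    ys↭ : ys ↭ w ∷ hs ++ ts
    ys↭ = ↭-trans (↭-reflexive-≋ ys≋) (shift refl hs ts)
    w∷ys′! : Unique (w ∷ hs ++ ts)
    w∷ys′! = Unique-resp-↭ ys↭ ys!
    ys′! : Unique (hs ++ ts)
    ys′! with _ ∷ ys′! ← w∷ys′! = ys′!
    xs⊆ys′ : ∀ {z} → z ∈ xs → z ∈ hs ++ ts
    xs⊆ys′ z∈xs with ∈-resp-↭ ys↭ (xs⊆ys (there z∈xs))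
    ... | here z≈w    = contradiction (∈-resp-≈ S (trans z≈w (sym x≈w)) z∈xs) (Unique[x∷xs]⇒x∉xs S x∷xs!)
    ... | there z∈ys′ = z∈ys′
    ys′⊆xs : ∀ {z} → z ∈ hs ++ ts → z ∈ xs
    ys′⊆xs z∈ys′ with ys⊆xs (∈-resp-↭ (↭-sym ys↭) (there z∈ys′))
    ... | here z≈x   = contradiction (∈-resp-≈ S (trans z≈x x≈w) z∈ys′) (Unique[x∷xs]⇒x∉xs S w∷ys′!)
    ... | there z∈xs = z∈xs

  map⁺-on : ∀ {f xs} → (∀ {x y} → x ∈ xs → y ∈ xs → f x ≈ f y → x ≈ y) → Unique xs → Unique (map f xs)
  map⁺-on {xs = []}         _ []                  = []
  map⁺-on {f} {xs = x ∷ xs} f-injective x∷xs!@(_ ∷ xs!) =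
    All.map⁺ (All.tabulateₛ S fx≉) ∷ map⁺-on (λ y∈xs z∈xs → f-injective (there y∈xs) (there z∈xs)) xs!
    where
    fx≉ : ∀ {y} → y ∈ xs → ¬ f x ≈ f y
    fx≉ y∈xs fx≈fy =
      Unique[x∷xs]⇒x∉xs S x∷xs! (∈-resp-≈ S (sym (f-injective (here refl) (there y∈xs) fx≈fy)) y∈xs)

  cartesianProductWith⁺-on : ∀ f {xs ys} →
    (∀ {w x y z} → w ∈ xs → x ∈ xs → y ∈ ys → z ∈ ys → f w y ≈ f x z → w ≈ x × y ≈ z) →
    Unique xs → Unique ys → Unique (cartesianProductWith f xs ys)
  cartesianProductWith⁺-on f {[]}     _ _ _ = []
  cartesianProductWith⁺-on f {x ∷ xs} {ys} f-injective x∷xs!@(_ ∷ xs!) ys! = ++⁺ S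
    (map⁺-on (λ y∈ys z∈ys → proj₂ ∘ f-injective (here refl) (here refl) y∈ys z∈ys) ys!)
    (cartesianProductWith⁺-on f (λ w∈xs x∈xs → f-injective (there w∈xs) (there x∈xs)) xs! ys!)
    disjoint
    where
    disjoint : ∀ {v} → v ∈ map (f x) ys × v ∈ cartesianProductWith f xs ys → ⊥
    disjoint (v∈map , v∈rest)
      with b , b∈ys , v≈fxb ← ∈-map⁻ S S v∈map
      with a , b′ , a∈xs , b′∈ys , v≈fab′ ← ∈-cartesianProductWith⁻ S S S f xs ys v∈rest =
      Unique[x∷xs]⇒x∉xs S x∷xs!
        (∈-resp-≈ S (sym (proj₁ (f-injective (here refl) (there a∈xs) b∈ys b′∈ys (trans (sym v≈fxb) v≈fab′)))) a∈xs)

module Arithmetic where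
  open import Data.Nat
  open import Data.Nat.Properties
  open import Data.Nat.Combinatorics using (_C_; nCk+nC[k+1]≡[n+1]C[k+1]; k>n⇒nCk≡0)
  open import Data.Nat.Divisibility using (_∣_; divides; ∣⇒≤)
  open import Data.Nat.Primality using (Prime; euclidsLemma)
  open import Data.Nat.DivMod using (_%_; _/_; m≡m%n+[m/n]*n; m%n<n)
  open ≡.≡-Reasoning

  [1+k]*[1+n]C[1+k]≡[1+n]*nCk : ∀ n k → suc k * (suc n C suc k) ≡ suc n * (n C k)
  [1+k]*[1+n]C[1+k]≡[1+n]*nCk zero zero = ≡.refl
  [1+k]*[1+n]C[1+k]≡[1+n]*nCk zero (suc k) = begin
    suc (suc k) * (1 C suc (suc k)) ≡⟨ ≡.cong (suc (suc k) *_) (k>n⇒nCk≡0 {1} {suc (suc k)} (s≤s (s≤s z≤n))) ⟩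
    suc (suc k) * 0                 ≡⟨ *-zeroʳ (suc (suc k)) ⟩
    0                               ≡⟨ ≡.cong (1 *_) (k>n⇒nCk≡0 {0} {suc k} (s≤s z≤n)) ⟨
    1 * (0 C suc k)                 ∎
  [1+k]*[1+n]C[1+k]≡[1+n]*nCk (suc n) zero = begin
    1 * (suc (suc n) C 1)           ≡⟨ *-identityˡ _ ⟩
    suc (suc n) C 1                 ≡⟨ nCk+nC[k+1]≡[n+1]C[k+1] (suc n) 0 ⟨
    1 + suc n C 1                   ≡⟨ ≡.cong suc (≡.sym (*-identityˡ _)) ⟩
    1 + 1 * (suc n C 1)             ≡⟨ ≡.cong suc ([1+k]*[1+n]C[1+k]≡[1+n]*nCk n zero) ⟩
    1 + suc n * 1                   ∎
  [1+k]*[1+n]C[1+k]≡[1+n]*nCk (suc n) (suc k) = begin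
    suc (suc k) * (suc (suc n) C suc (suc k))   ≡⟨ ≡.cong (suc (suc k) *_) (nCk+nC[k+1]≡[n+1]C[k+1] (suc n) (suc k)) ⟨
    suc (suc k) * (A + B)                       ≡⟨ *-distribˡ-+ (suc (suc k)) A B ⟩
    suc (suc k) * A + suc (suc k) * B           ≡⟨ ≡.cong (suc (suc k) * A +_) ([1+k]*[1+n]C[1+k]≡[1+n]*nCk n (suc k)) ⟩
    (A + suc k * A) + suc n * (n C suc k)       ≡⟨ ≡.cong (λ z → (A + z) + suc n * (n C suc k)) ([1+k]*[1+n]C[1+k]≡[1+n]*nCk n k) ⟩
    (A + suc n * (n C k)) + suc n * (n C suc k) ≡⟨ +-assoc A _ _ ⟩
    A + (suc n * (n C k) + suc n * (n C suc k)) ≡⟨ ≡.cong (A +_) (*-distribˡ-+ (suc n) (n C k) (n C suc k)) ⟨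
    A + suc n * (n C k + n C suc k)             ≡⟨ ≡.cong (λ z → A + suc n * z) (nCk+nC[k+1]≡[n+1]C[k+1] n k) ⟩
    suc (suc n) * A                             ∎
    where
    A B : ℕ
    A = suc n C suc k
    B = suc n C suc (suc k)

  prime∣pCk : ∀ {p k} → Prime p → 0 < k → k < p → p ∣ p C k
  prime∣pCk {suc n} {suc k} p-prime _ k<p
    with euclidsLemma (suc k) (suc n C suc k) p-prime
           (divides (n C k) (≡.trans ([1+k]*[1+n]C[1+k]≡[1+n]*nCk n k) (*-comm (suc n) (n C k))))
  ... | inj₁ p∣k = contradiction (∣⇒≤ p∣k) (<⇒≱ k<p)
  ... | inj₂ p∣C = p∣C

  [1+j]*d≤r+d*j⇒d≤r : ∀ d j r → suc j * d ≤ r + d * j → d ≤ r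
  [1+j]*d≤r+d*j⇒d≤r d j r h = +-cancelʳ-≤ (d * j) d r (≡.subst (_≤ r + d * j) (≡.trans (*-comm (suc j) d) (*-suc d j)) h)

  m*n≡q*q⇒m≡q : ∀ {m n q} → m ≤ q → n ≤ q → m * n ≡ q * q → m ≡ q
  m*n≡q*q⇒m≡q {m} {n} {q} m≤q n≤q m*n≡q*q = ≤-antisym m≤q (≮⇒≥ λ m<q →
    <-irrefl m*n≡q*q (≤-<-trans (*-monoʳ-≤ m n≤q) (*-monoˡ-< q {{>-nonZero (≤-<-trans z≤n m<q)}} m<q)))

  odd⇒≡1+r*2 : ∀ {n} → ¬ 2 ∣ n → ∃ λ r → n ≡ suc (r * 2)
  odd⇒≡1+r*2 {n} 2∤n with n % 2 | m≡m%n+[m/n]*n n 2 | m%n<n n 2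
  ... | zero        | n≡[n/2]*2   | _ = contradiction (divides (n / 2) n≡[n/2]*2) 2∤n
  ... | suc zero    | n≡1+[n/2]*2 | _ = n / 2 , n≡1+[n/2]*2
  ... | suc (suc _) | _           | s≤s (s≤s ())

module Field {c ℓ} (K : FiniteField c ℓ) where
  open FiniteField K public hiding (zero)
  open IntegerCoefficientSolver commRing public using (solve; _:=_; _:+_; _:*_; _:-_; :-_; :0; :1)
  open import Algebra.Properties.Ring ring public using (-‿involutive; -‿distribˡ-*; -‿distribʳ-*; -0#≈0#)
  open import Algebra.Properties.Group +-group public using (inverseʳ-unique; x∙y⁻¹≈ε⇒x≈y; x≈y⇒x∙y⁻¹≈ε)
  open import Algebra.Properties.Semiring.Exp semiring public using (^-homo-*; ^-assocʳ; ^-congˡ; ^-congʳ)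
  open import Algebra.Properties.CommutativeSemiring.Exp commutativeSemiring public using (^-distrib-*)
  open import Relation.Binary.Reasoning.Setoid setoid public

  -- Junk value: 0# ⁻¹ = 0#.
  infix 9 _⁻¹

  _⁻¹ : Carrier → Carrier
  x ⁻¹ with x ≟ 0#
  ... | yes _  = 0#
  ... | no x≉0 = proj₁ (inverse x x≉0)

  ⁻¹-inverseʳ : ∀ {x} → ¬ x ≈ 0# → x * x ⁻¹ ≈ 1#
  ⁻¹-inverseʳ {x} x≉0 with x ≟ 0#
  ... | yes x≈0 = contradiction x≈0 x≉0
  ... | no x≉0  = proj₂ (inverse x x≉0)

  ⁻¹-inverseˡ : ∀ {x} → ¬ x ≈ 0# → x ⁻¹ * x ≈ 1#
  ⁻¹-inverseˡ x≉0 = trans (*-comm _ _) (⁻¹-inverseʳ x≉0)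

  *-cancelˡ : ∀ {x y z} → ¬ x ≈ 0# → x * y ≈ x * z → y ≈ z
  *-cancelˡ {x} {y} {z} x≉0 xy≈xz = begin
    y                ≈⟨ *-identityˡ y ⟨
    1# * y           ≈⟨ *-congʳ (⁻¹-inverseˡ x≉0) ⟨
    (x ⁻¹ * x) * y   ≈⟨ *-assoc (x ⁻¹) x y ⟩
    x ⁻¹ * (x * y)   ≈⟨ *-congˡ xy≈xz ⟩
    x ⁻¹ * (x * z)   ≈⟨ *-assoc (x ⁻¹) x z ⟨
    (x ⁻¹ * x) * z   ≈⟨ *-congʳ (⁻¹-inverseˡ x≉0) ⟩
    1# * z           ≈⟨ *-identityˡ z ⟩
    z                ∎

  zero-product : ∀ {x y} → x * y ≈ 0# → x ≈ 0# ⊎ y ≈ 0#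
  zero-product {x} {y} xy≈0 with x ≟ 0#
  ... | yes x≈0 = inj₁ x≈0
  ... | no x≉0  = inj₂ (*-cancelˡ x≉0 (trans xy≈0 (sym (zeroʳ x))))

  *-nonzero : ∀ {x y} → ¬ x ≈ 0# → ¬ y ≈ 0# → ¬ x * y ≈ 0#
  *-nonzero x≉0 y≉0 xy≈0 = [ x≉0 , y≉0 ] (zero-product xy≈0)

  ^-nonzero : ∀ {x} n → ¬ x ≈ 0# → ¬ x ^ n ≈ 0#
  ^-nonzero zero    _   = 1≉0
  ^-nonzero (suc n) x≉0 = *-nonzero x≉0 (^-nonzero n x≉0)

  ^≈0⇒≈0 : ∀ {x} n → x ^ n ≈ 0# → x ≈ 0#
  ^≈0⇒≈0 {x} n xⁿ≈0 with x ≟ 0#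
  ... | yes x≈0 = x≈0
  ... | no x≉0  = contradiction xⁿ≈0 (^-nonzero n x≉0)

  0^n≈0 : ∀ {n} → 0 < n → 0# ^ n ≈ 0#
  0^n≈0 {suc n} _ = zeroˡ _

  1^n≈1 : ∀ n → 1# ^ n ≈ 1#
  1^n≈1 zero    = refl
  1^n≈1 (suc n) = trans (*-identityˡ _) (1^n≈1 n)

  -‿^-even : ∀ k x → (- x) ^ (k ℕ.* 2) ≈ x ^ (k ℕ.* 2)
  -‿^-even zero    x = refl
  -‿^-even (suc k) x = begin
    - x * (- x * (- x) ^ (k ℕ.* 2))  ≈⟨ *-congˡ (*-congˡ (-‿^-even k x)) ⟩
    - x * (- x * x ^ (k ℕ.* 2))      ≈⟨ solve 2 (λ x y → (:- x) :* ((:- x) :* y) := x :* (x :* y)) refl x (x ^ (k ℕ.* 2)) ⟩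
    x * (x * x ^ (k ℕ.* 2))          ∎

  ^-multiple≈1 : ∀ {t d} e → t ^ d ≈ 1# → t ^ (e ℕ.* d) ≈ 1#
  ^-multiple≈1 {t} {d} e tᵈ≈1 = begin
    t ^ (e ℕ.* d)  ≡⟨ ≡.cong (t ^_) (ℕ.*-comm e d) ⟩
    t ^ (d ℕ.* e)  ≈⟨ ^-assocʳ t d e ⟨
    (t ^ d) ^ e    ≈⟨ ^-congˡ e tᵈ≈1 ⟩
    1# ^ e         ≈⟨ 1^n≈1 e ⟩
    1#             ∎

  ^-∣ : ∀ {t d e} → d ∣ e → t ^ d ≈ 1# → t ^ e ≈ 1#
  ^-∣ (divides e ≡.refl) = ^-multiple≈1 e

  ^-cancel≈1 : ∀ {t a b c} → t ^ a ≈ 1# → t ^ b ≈ 1# → c ℕ.+ a ≡ b → t ^ c ≈ 1#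
  ^-cancel≈1 {t} {a} {b} {c} tᵃ≈1 tᵇ≈1 c+a≡b = begin
    t ^ c            ≈⟨ *-identityʳ _ ⟨
    t ^ c * 1#       ≈⟨ *-congˡ tᵃ≈1 ⟨
    t ^ c * t ^ a    ≈⟨ ^-homo-* t c a ⟨
    t ^ (c ℕ.+ a)    ≡⟨ ≡.cong (t ^_) c+a≡b ⟩
    t ^ b            ≈⟨ tᵇ≈1 ⟩
    1#               ∎

  ^-gcd : ∀ {t m n} → t ^ m ≈ 1# → t ^ n ≈ 1# → t ^ gcd m n ≈ 1#
  ^-gcd {t} {m} {n} tᵐ≈1 tⁿ≈1 with Bézout.identity (gcd-GCD m n)
  ... | Bézout.+- x y g+yn≡xm = ^-cancel≈1 {c = gcd m n} (^-multiple≈1 y tⁿ≈1) (^-multiple≈1 x tᵐ≈1) g+yn≡xm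
  ... | Bézout.-+ x y g+xm≡yn = ^-cancel≈1 {c = gcd m n} (^-multiple≈1 x tᵐ≈1) (^-multiple≈1 y tⁿ≈1) g+xm≡yn

  ⁻¹-unique : ∀ {x y} → ¬ x ≈ 0# → x * y ≈ 1# → y ≈ x ⁻¹
  ⁻¹-unique x≉0 xy≈1 = *-cancelˡ x≉0 (trans xy≈1 (sym (⁻¹-inverseʳ x≉0)))

  ⁻¹-nonzero : ∀ {x} → ¬ x ≈ 0# → ¬ x ⁻¹ ≈ 0#
  ⁻¹-nonzero x≉0 x⁻¹≈0 = 1≉0 (trans (sym (⁻¹-inverseʳ x≉0)) (trans (*-congˡ x⁻¹≈0) (zeroʳ _)))

  ⁻¹-0 : ∀ {x} → x ≈ 0# → x ⁻¹ ≈ 0#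
  ⁻¹-0 {x} x≈0 with x ≟ 0#
  ... | yes _   = refl
  ... | no x≉0  = contradiction x≈0 x≉0

  ⁻¹-cong : ∀ {x y} → x ≈ y → x ⁻¹ ≈ y ⁻¹
  ⁻¹-cong {x} {y} x≈y = by-cases (x ≟ 0#)
    where
    by-cases : Dec (x ≈ 0#) → x ⁻¹ ≈ y ⁻¹
    by-cases (yes x≈0) = trans (⁻¹-0 x≈0) (sym (⁻¹-0 (trans (sym x≈y) x≈0)))
    by-cases (no x≉0)  = sym (⁻¹-unique x≉0 (trans (*-congʳ x≈y) (⁻¹-inverseʳ (λ y≈0 → x≉0 (trans x≈y y≈0)))))

  *-cancel-⁻¹ : ∀ {x} y → ¬ x ≈ 0# → x * (y * x ⁻¹) ≈ y
  *-cancel-⁻¹ {x} y x≉0 = begin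
    x * (y * x ⁻¹)  ≈⟨ solve 3 (λ x y i → x :* (y :* i) := y :* (x :* i)) refl x y (x ⁻¹) ⟩
    y * (x * x ⁻¹)  ≈⟨ *-congˡ (⁻¹-inverseʳ x≉0) ⟩
    y * 1#          ≈⟨ *-identityʳ y ⟩
    y               ∎

  -‿⁻¹ : ∀ {x} → ¬ x ≈ 0# → (- x) ⁻¹ ≈ - x ⁻¹
  -‿⁻¹ {x} x≉0 = sym (⁻¹-unique -x≉0 (trans (solve 2 (λ x i → (:- x) :* (:- i) := x :* i) refl x (x ⁻¹)) (⁻¹-inverseʳ x≉0)))
    where
    -x≉0 : ¬ - x ≈ 0#
    -x≉0 -x≈0 = x≉0 (trans (sym (-‿involutive x)) (trans (-‿cong -x≈0) -0#≈0#))

module Counting {c ℓ} (K : FiniteField c ℓ) where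
  open FiniteField K
  open import Data.List.Membership.Setoid setoid using (_∈_)
  open import Data.List.Membership.Setoid.Properties
    using (∈-tabulate⁺; ∈-filter⁺; ∈-filter⁻; ∈-resp-≈; ∈-map⁺; ∈-map⁻; ∈-cartesianProductWith⁺; ∈-cartesianProductWith⁻)
  open import Data.List.Relation.Unary.Unique.Setoid setoid using (Unique)
  open import Data.List.Relation.Unary.Unique.Setoid.Properties using (tabulate⁺; filter⁺)
  open import Data.List.Relation.Binary.Permutation.Setoid.Properties setoid using (xs↭ys⇒|xs|≡|ys|)
  open import Data.List.Properties
    using (length-map; length-++; length-tabulate; map-tabulate; filter-≐; filter-none; filter-all)
  open UniqueLists setoid

  elements : List Carrier
  elements = tabulate enum

  ∈-elements : ∀ x → x ∈ elements
  ∈-elements x with i , enum-i≈x ← enum-surj x = ∈-resp-≈ setoid enum-i≈x (∈-tabulate⁺ setoid i)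

  elements-unique : Unique elements
  elements-unique = tabulate⁺ setoid (enum-inj _ _)

  length-elements : length elements ≡ size
  length-elements = length-tabulate enum

  module _ {p} {P : Pred Carrier p} (P? : Decidable P) where

    counted : List Carrier
    counted = filter P? elements

    count : ℕ
    count = length counted

    counted-unique : Unique counted
    counted-unique = filter⁺ setoid P? elements-unique

    count≡0⊎∃ : count ≡ 0 ⊎ ∃ P
    count≡0⊎∃ with counted | All.all-filter P? elements
    ... | []    | _      = inj₁ ≡.refl
    ... | x ∷ _ | Px ∷ _ = inj₂ (x , Px)

    count≡0 : (∀ x → ¬ P x) → count ≡ 0
    count≡0 ¬P = ≡.cong length (filter-none P? (All.universal ¬P elements))

    count≡size : (∀ x → P x) → count ≡ size
    count≡size all-P = ≡.trans (≡.cong length (filter-all P? (All.universal all-P elements))) length-elements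

    module _ (P-resp : P Respects _≈_) where

      ∈-counted⁻ : ∀ {x} → x ∈ counted → P x
      ∈-counted⁻ = proj₂ ∘ ∈-filter⁻ setoid P? P-resp {xs = elements}

      ∈-counted⁺ : ∀ {x} → P x → x ∈ counted
      ∈-counted⁺ = ∈-filter⁺ setoid P? P-resp (∈-elements _)

      count≡length : ∀ {xs} → Unique xs → (∀ {x} → x ∈ xs → P x) → (∀ {x} → P x → x ∈ xs) → count ≡ length xs
      count≡length xs! xs⊆P P⊆xs =
        xs↭ys⇒|xs|≡|ys| (↭-unique counted-unique xs! (P⊆xs ∘ ∈-counted⁻) (∈-counted⁺ ∘ xs⊆P))

  count-cong : ∀ {p q} {P : Pred Carrier p} {Q : Pred Carrier q} (P? : Decidable P) (Q? : Decidable Q) →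
               P ≐ Q → count P? ≡ count Q?
  count-cong P? Q? P≐Q = ≡.cong length (filter-≐ P? Q? P≐Q elements)

  count-≈ : ∀ a → count (_≟ a) ≡ 1
  count-≈ a = count≡length (_≟ a) (λ x≈y x≈a → trans (sym x≈y) x≈a) ([] ∷ []) (λ { (here x≈a) → x≈a }) here

  count+count∁≡size : ∀ {p} {P : Pred Carrier p} (P? : Decidable P) → count P? ℕ.+ count (∁? P?) ≡ size
  count+count∁≡size P? = ≡.trans (split elements) length-elements
    where
    split : ∀ xs → length (filter P? xs) ℕ.+ length (filter (∁? P?) xs) ≡ length xs
    split []       = ≡.refl
    split (x ∷ xs) with P? x
    ... | yes _ = ≡.cong suc (split xs)
    ... | no _  = ≡.trans (ℕ.+-suc _ _) (≡.cong suc (split xs))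

  count-∪ : ∀ {p q r} {P : Pred Carrier p} {Q : Pred Carrier q} {R : Pred Carrier r}
            (P? : Decidable P) (Q? : Decidable Q) (R? : Decidable R) →
            (∀ {x} → P x → Q x ⊎ R x) → count P? ≤ count Q? ℕ.+ count R?
  count-∪ P? Q? R? P⊆Q∪R = bound elements
    where
    bound : ∀ xs → length (filter P? xs) ≤ length (filter Q? xs) ℕ.+ length (filter R? xs)
    bound [] = z≤n
    bound (x ∷ xs) with P? x | Q? x | R? x
    ... | no _  | no _  | no _  = bound xs
    ... | no _  | no _  | yes _ = ℕ.≤-trans (bound xs) (ℕ.+-monoʳ-≤ _ (ℕ.n≤1+n _))
    ... | no _  | yes _ | no _  = ℕ.m≤n⇒m≤1+n (bound xs)
    ... | no _  | yes _ | yes _ = ℕ.m≤n⇒m≤1+n (ℕ.≤-trans (bound xs) (ℕ.+-monoʳ-≤ _ (ℕ.n≤1+n _)))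
    ... | yes _ | yes _ | no _  = s≤s (bound xs)
    ... | yes _ | yes _ | yes _ = s≤s (ℕ.≤-trans (bound xs) (ℕ.+-monoʳ-≤ _ (ℕ.n≤1+n _)))
    ... | yes _ | no _  | yes _ = ℕ.≤-trans (s≤s (bound xs)) (ℕ.≤-reflexive (≡.sym (ℕ.+-suc _ _)))
    ... | yes p | no ¬q | no ¬r = [ ⊥-elim ∘ ¬q , ⊥-elim ∘ ¬r ] (P⊆Q∪R p)

  fiberCount≡count : ∀ g α → fiberCount g α ≡ count (λ x → g x ≟ α)
  fiberCount≡count g α = ≡.trans (length-filter-map (allFin size))
    (≡.cong (length ∘ filter (λ x → g x ≟ α)) (map-tabulate id enum))
    where
    length-filter-map : ∀ is → length (filter (λ i → g (enum i) ≟ α) is) ≡ length (filter (λ x → g x ≟ α) (map enum is))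
    length-filter-map []       = ≡.refl
    length-filter-map (i ∷ is) with g (enum i) ≟ α
    ... | yes _ = ≡.cong suc (length-filter-map is)
    ... | no _  = length-filter-map is

  module _ {p q} {P : Pred Carrier p} {Q : Pred Carrier q} (P? : Decidable P) (Q? : Decidable Q)
           (P-resp : P Respects _≈_) (Q-resp : Q Respects _≈_) where

    count-image : (f : Carrier → Carrier) → (∀ {x y} → x ≈ y → f x ≈ f y) →
                  (∀ {x} → P x → Q (f x)) → (∀ {x y} → P x → P y → f x ≈ f y → x ≈ y) →
                  (∀ {y} → Q y → ∃ λ x → P x × y ≈ f x) → count Q? ≡ count P?
    count-image f f-cong P⇒Q f-injective Q⇒image = ≡.trans
      (count≡length Q? Q-resp (map⁺-on (λ x∈ y∈ → f-injective (∈P⁻ x∈) (∈P⁻ y∈)) (counted-unique P?))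
        image⇒Q Q⇒∈image)
      (length-map f (counted P?))
      where
      ∈P⁻ : ∀ {x} → x ∈ counted P? → P x
      ∈P⁻ = ∈-counted⁻ P? P-resp
      image⇒Q : ∀ {y} → y ∈ map f (counted P?) → Q y
      image⇒Q y∈ with x , x∈ , y≈fx ← ∈-map⁻ setoid setoid y∈ = Q-resp (sym y≈fx) (P⇒Q (∈P⁻ x∈))
      Q⇒∈image : ∀ {y} → Q y → y ∈ map f (counted P?)
      Q⇒∈image Qy with x , Px , y≈fx ← Q⇒image Qy =
        ∈-resp-≈ setoid (sym y≈fx) (∈-map⁺ setoid setoid f-cong (∈-counted⁺ P? P-resp Px))

    count-⊕ : ∀ {t} {T : Pred Carrier t} (T? : Decidable T) → T Respects _≈_ →
              (∀ {a b a′ b′} → P a → P a′ → Q b → Q b′ → a + b ≈ a′ + b′ → a ≈ a′ × b ≈ b′) →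
              (∀ {a b} → P a → Q b → T (a + b)) →
              (∀ {x} → T x → ∃ λ a → ∃ λ b → P a × Q b × x ≈ a + b) →
              count T? ≡ count P? ℕ.* count Q?
    count-⊕ {T = T} T? T-resp +-injective P⊕Q⇒T T⇒P⊕Q = ≡.trans
      (count≡length T? T-resp
        (cartesianProductWith⁺-on _+_ (λ a∈ a′∈ b∈ b′∈ → +-injective (∈P⁻ a∈) (∈P⁻ a′∈) (∈Q⁻ b∈) (∈Q⁻ b′∈))
          (counted-unique P?) (counted-unique Q?))
        sum⇒T T⇒∈sums)
      (length-cartesianProductWith (counted P?) (counted Q?))
      where
      ∈P⁻ : ∀ {x} → x ∈ counted P? → P x
      ∈P⁻ = ∈-counted⁻ P? P-resp
      ∈Q⁻ : ∀ {x} → x ∈ counted Q? → Q x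
      ∈Q⁻ = ∈-counted⁻ Q? Q-resp
      sum⇒T : ∀ {x} → x ∈ cartesianProductWith _+_ (counted P?) (counted Q?) → T x
      sum⇒T x∈ with a , b , a∈ , b∈ , x≈a+b ← ∈-cartesianProductWith⁻ setoid setoid setoid _+_ _ _ x∈ =
        T-resp (sym x≈a+b) (P⊕Q⇒T (∈P⁻ a∈) (∈Q⁻ b∈))
      T⇒∈sums : ∀ {x} → T x → x ∈ cartesianProductWith _+_ (counted P?) (counted Q?)
      T⇒∈sums Tx with a , b , Pa , Qb , x≈a+b ← T⇒P⊕Q Tx = ∈-resp-≈ setoid (sym x≈a+b)
        (∈-cartesianProductWith⁺ setoid setoid setoid +-cong (∈-counted⁺ P? P-resp Pa) (∈-counted⁺ Q? Q-resp Qb))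
      length-cartesianProductWith : ∀ xs ys → length (cartesianProductWith _+_ xs ys) ≡ length xs ℕ.* length ys
      length-cartesianProductWith []       ys = ≡.refl
      length-cartesianProductWith (x ∷ xs) ys = ≡.trans (length-++ (map (x +_) ys))
        (≡.cong₂ ℕ._+_ (length-map (x +_) ys) (length-cartesianProductWith xs ys))

module Polynomials {c ℓ} (K : FiniteField c ℓ) where
  open Field K
  open Counting K
  open import Data.List.Relation.Unary.Unique.Setoid setoid using (Unique)

  -- Poly d f (Monic d f): f agrees pointwise with a polynomial of degree ≤ d (monic of degree d),
  -- presented in Horner form.
  data Poly : ℕ → (Carrier → Carrier) → Set (c ⊔ ℓ) where
    const  : ∀ {f} a → (∀ x → f x ≈ a) → Poly 0 f
    horner : ∀ {d f} g a → Poly d g → (∀ x → f x ≈ x * g x + a) → Poly (suc d) f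

  data Monic : ℕ → (Carrier → Carrier) → Set (c ⊔ ℓ) where
    one    : ∀ {f} → (∀ x → f x ≈ 1#) → Monic 0 f
    horner : ∀ {d f} g a → Monic d g → (∀ x → f x ≈ x * g x + a) → Monic (suc d) f

  monic⇒poly : ∀ {d f} → Monic d f → Poly d f
  monic⇒poly (one f≈1)          = const 1# f≈1
  monic⇒poly (horner g a mg f≈) = horner g a (monic⇒poly mg) f≈

  monic-+ : ∀ {d e f g} → e < d → Monic d f → Poly e g → Monic d (λ x → f x + g x)
  monic-+ {f = f} {g} _ (horner f′ a mf f≈) (const b g≈b) = horner f′ (a + b) mf λ x → begin
    f x + g x             ≈⟨ +-cong (f≈ x) (g≈b x) ⟩
    (x * f′ x + a) + b    ≈⟨ +-assoc _ _ _ ⟩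
    x * f′ x + (a + b)    ∎
  monic-+ {f = f} {g} (s≤s e<d) (horner f′ a mf f≈) (horner g′ b pg g≈) =
    horner (λ x → f′ x + g′ x) (a + b) (monic-+ e<d mf pg) λ x → begin
      f x + g x                       ≈⟨ +-cong (f≈ x) (g≈ x) ⟩
      (x * f′ x + a) + (x * g′ x + b)
        ≈⟨ solve 5 (λ x u a v b → (x :* u :+ a) :+ (x :* v :+ b) := x :* (u :+ v) :+ (a :+ b)) refl x (f′ x) a (g′ x) b ⟩
      x * (f′ x + g′ x) + (a + b)     ∎

  monic-^ : ∀ e → Monic e (_^ e)
  monic-^ zero    = one (λ _ → refl)
  monic-^ (suc e) = horner (_^ e) 0# (monic-^ e) (λ _ → sym (+-identityʳ _))

  factor-theorem : ∀ {d f} → Monic (suc d) f → ∀ r → ∃ λ h → Monic d h × (∀ x → f x ≈ (x - r) * h x + f r)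
  factor-theorem {zero} {f} (horner g a (one g≈1) f≈) r = (λ _ → 1#) , one (λ _ → refl) , λ x → begin
    f x                           ≈⟨ f≈ x ⟩
    x * g x + a                   ≈⟨ +-congʳ (*-congˡ (g≈1 x)) ⟩
    x * 1# + a                    ≈⟨ solve 3 (λ x r a → x :* :1 :+ a := (x :- r) :* :1 :+ (r :* :1 :+ a)) refl x r a ⟩
    (x - r) * 1# + (r * 1# + a)   ≈⟨ +-congˡ (+-congʳ (*-congˡ (g≈1 r))) ⟨
    (x - r) * 1# + (r * g r + a)  ≈⟨ +-congˡ (f≈ r) ⟨
    (x - r) * 1# + f r            ∎
  factor-theorem {suc d} {f} (horner g a mg f≈) r with h , mh , g≈ ← factor-theorem mg r =
    (λ x → x * h x + g r) , horner h (g r) mh (λ _ → refl) , λ x → begin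
      f x                                       ≈⟨ f≈ x ⟩
      x * g x + a                               ≈⟨ +-congʳ (*-congˡ (g≈ x)) ⟩
      x * ((x - r) * h x + g r) + a
        ≈⟨ solve 5 (λ x r h g a → x :* ((x :- r) :* h :+ g) :+ a := (x :- r) :* (x :* h :+ g) :+ (r :* g :+ a))
                   refl x r (h x) (g r) a ⟩
      (x - r) * (x * h x + g r) + (r * g r + a) ≈⟨ +-congˡ (f≈ r) ⟨
      (x - r) * (x * h x + g r) + f r           ∎

  roots≤degree : ∀ {d f xs} → Monic d f → Unique xs → All (λ x → f x ≈ 0#) xs → length xs ≤ d
  roots≤degree {xs = []}    _         _ _          = z≤n
  roots≤degree {xs = x ∷ _} (one f≈1) _ (fx≈0 ∷ _) = contradiction (trans (sym (f≈1 x)) fx≈0) 1≉0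
  roots≤degree {suc d} {f} {r ∷ xs} m@(horner _ _ _ _) (r≉ ∷ xs!) (fr≈0 ∷ fxs≈0)
    with h , mh , f≈ ← factor-theorem m r = s≤s (roots≤degree mh xs! (All.zipWith root-of-h (r≉ , fxs≈0)))
    where
    root-of-h : ∀ {y} → ¬ r ≈ y × f y ≈ 0# → h y ≈ 0#
    root-of-h {y} (r≉y , fy≈0) with zero-product {y - r} {h y} (begin
      (y - r) * h y       ≈⟨ +-identityʳ _ ⟨
      (y - r) * h y + 0#  ≈⟨ +-congˡ fr≈0 ⟨
      (y - r) * h y + f r ≈⟨ f≈ y ⟨
      f y                 ≈⟨ fy≈0 ⟩
      0#                  ∎)
    ... | inj₁ y-r≈0 = contradiction (sym (x∙y⁻¹≈ε⇒x≈y y r y-r≈0)) r≉y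
    ... | inj₂ hy≈0  = hy≈0

  count-roots≤degree : ∀ {d f} → Monic d f → count (λ x → f x ≟ 0#) ≤ d
  count-roots≤degree {f = f} m =
    roots≤degree m (counted-unique (λ x → f x ≟ 0#)) (All.all-filter (λ x → f x ≟ 0#) elements)

  monic-^-+ : ∀ {d e g} → d < e → Poly d g → Monic e (λ x → x ^ e + g x)
  monic-^-+ {e = e} d<e = monic-+ d<e (monic-^ e)

  poly-neg-x : Poly 1 (λ x → - x)
  poly-neg-x = horner (λ _ → - 1#) 0# (const (- 1#) (λ _ → refl))
    (λ x → solve 1 (λ x → :- x := x :* (:- :1) :+ :0) refl x)

  poly-x : Poly 1 (λ x → x)
  poly-x = horner (λ _ → 1#) 0# (const 1# (λ _ → refl)) (λ x → solve 1 (λ x → x := x :* :1 :+ :0) refl x)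

  monic-^-x : ∀ {e} → 1 < e → Monic e (λ x → x ^ e - x)
  monic-^-x 1<e = monic-^-+ 1<e poly-neg-x

  monic-^+x : ∀ {e} → 1 < e → Monic e (λ x → x ^ e + x)
  monic-^+x 1<e = monic-^-+ 1<e poly-x

  monic-^-1 : ∀ {e} → 0 < e → Monic e (λ x → x ^ e - 1#)
  monic-^-1 0<e = monic-^-+ 0<e (const (- 1#) (λ _ → refl))

  geometric : ℕ → ℕ → Carrier → Carrier
  geometric d zero    t = 0#
  geometric d (suc j) t = t ^ (d ℕ.* j) + geometric d j t

  geometric-identity : ∀ d j t → (t ^ d - 1#) * geometric d j t ≈ t ^ (d ℕ.* j) - 1#
  geometric-identity d zero t = begin
    (t ^ d - 1#) * 0#   ≈⟨ zeroʳ _ ⟩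
    0#                  ≈⟨ -‿inverseʳ 1# ⟨
    1# - 1#             ≡⟨ ≡.cong (λ k → t ^ k - 1#) (ℕ.*-zeroʳ d) ⟨
    t ^ (d ℕ.* 0) - 1#  ∎
  geometric-identity d (suc j) t = begin
    (tᵈ - 1#) * (tᵈʲ + geometric d j t)   ≈⟨ solve 3 (λ a b h → (a :- :1) :* (b :+ h) := (a :* b :- b) :+ (a :- :1) :* h) refl tᵈ tᵈʲ (geometric d j t) ⟩
    (tᵈ * tᵈʲ - tᵈʲ) + (tᵈ - 1#) * geometric d j t ≈⟨ +-congˡ (geometric-identity d j t) ⟩
    (tᵈ * tᵈʲ - tᵈʲ) + (tᵈʲ - 1#)         ≈⟨ solve 2 (λ a b → (a :- b) :+ (b :- :1) := a :- :1) refl (tᵈ * tᵈʲ) tᵈʲ ⟩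
    tᵈ * tᵈʲ - 1#                         ≈⟨ +-congʳ (^-homo-* t d (d ℕ.* j)) ⟨
    t ^ (d ℕ.+ d ℕ.* j) - 1#              ≡⟨ ≡.cong (λ k → t ^ k - 1#) (ℕ.*-suc d j) ⟨
    t ^ (d ℕ.* suc j) - 1#                ∎
    where
    tᵈ tᵈʲ : Carrier
    tᵈ  = t ^ d
    tᵈʲ = t ^ (d ℕ.* j)

  monic-geometric : ∀ {d} → 0 < d → ∀ j → Monic (d ℕ.* j) (geometric d (suc j))
  monic-geometric {d} _ zero = ≡.subst (λ k → Monic k (geometric d 1)) (≡.sym (ℕ.*-zeroʳ d))
    (one (λ t → trans (+-identityʳ _) (^-congʳ t (ℕ.*-zeroʳ d))))
  monic-geometric {d} 0<d (suc j) =
    monic-^-+ (ℕ.*-monoʳ-< d {{ℕ.>-nonZero 0<d}} (ℕ.n<1+n j)) (monic⇒poly (monic-geometric 0<d j))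

  rootOfUnity? : ∀ d → Decidable (λ t → t ^ d ≈ 1#)
  rootOfUnity? d t = (t ^ d) ≟ 1#

  #roots-of-unity≤d : ∀ {d} → 0 < d → count (rootOfUnity? d) ≤ d
  #roots-of-unity≤d {d} 0<d = ℕ.≤-trans
    (ℕ.≤-reflexive (count-cong (rootOfUnity? d) (λ t → (t ^ d - 1#) ≟ 0#) (x≈y⇒x∙y⁻¹≈ε , x∙y⁻¹≈ε⇒x≈y _ _)))
    (count-roots≤degree (monic-^-1 0<d))

module Characteristic {c ℓ} (K : FiniteField c ℓ) where
  open Field K
  open Counting K
  open UniqueLists setoid
  open import Algebra.Properties.Semiring.Mult semiring using (×1-homo-*; ×-assoc-*; ×-congʳ)
  open import Algebra.Properties.Semiring.Mult semiring public using () renaming (_×_ to _·_)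
  open import Data.List using (foldr)
  open import Data.List.Membership.Setoid setoid using (_∈_)
  open import Data.List.Membership.Setoid.Properties using (∈-resp-≈; ∈-map⁺; ∈-map⁻)
  open import Data.List.Relation.Binary.Permutation.Setoid setoid using (_↭_; ↭-sym)
  open import Data.List.Relation.Binary.Permutation.Setoid.Properties setoid using (foldr-commMonoid)
  open import Algebra.Properties.Group +-group using (identityʳ-unique; ∙-cancelʳ)
  open import Algebra.Properties.Monoid.Sum +-monoid using (sum)
  open import Algebra.Properties.CommutativeSemiring.Binomial commutativeSemiring using (theorem; binomialTerm)
  open import Data.Fin as Fin using (toℕ; fromℕ)
  open import Data.Fin.Properties using (toℕ-fromℕ)
  open import Data.Nat.Combinatorics using (_C_; nCn≡1)
  open import Data.Vec.Functional using (Vector)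
  open Arithmetic using (prime∣pCk; odd⇒≡1+r*2)

  listSum : List Carrier → Carrier
  listSum = foldr _+_ 0#

  listSum-map-+1 : ∀ xs → listSum (map (_+ 1#) xs) ≈ listSum xs + length xs · 1#
  listSum-map-+1 []       = sym (+-identityʳ _)
  listSum-map-+1 (x ∷ xs) = begin
    (x + 1#) + listSum (map (_+ 1#) xs)       ≈⟨ +-congˡ (listSum-map-+1 xs) ⟩
    (x + 1#) + (listSum xs + length xs · 1#)
      ≈⟨ solve 3 (λ x s n → (x :+ :1) :+ (s :+ n) := (x :+ s) :+ (:1 :+ n)) refl x (listSum xs) (length xs · 1#) ⟩
    (x + listSum xs) + (1# + length xs · 1#)  ∎

  -- Translation by 1 permutes K, so Σ x = Σ (x + 1) = Σ x + |K|·1.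
  size·1≈0 : size · 1# ≈ 0#
  size·1≈0 = identityʳ-unique (listSum elements) (size · 1#) (begin
    listSum elements + size · 1#             ≡⟨ ≡.cong (λ n → listSum elements + n · 1#) length-elements ⟨
    listSum elements + length elements · 1#  ≈⟨ listSum-map-+1 elements ⟨
    listSum (map (_+ 1#) elements)           ≈⟨ foldr-commMonoid +-isCommutativeMonoid (↭-sym translation-↭) ⟩
    listSum elements                         ∎)
    where
    translation-↭ : elements ↭ map (_+ 1#) elements
    translation-↭ = ↭-unique elements-unique (map⁺-on (λ _ _ → ∙-cancelʳ 1# _ _) elements-unique)
      (λ {z} _ → ∈-resp-≈ setoid (solve 1 (λ z → (z :- :1) :+ :1 := z) refl z)
                   (∈-map⁺ setoid setoid +-congʳ (∈-elements (z - 1#))))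
      (λ {z} _ → ∈-elements z)

  ^-·1 : ∀ p m → (p ℕ.^ m) · 1# ≈ (p · 1#) ^ m
  ^-·1 p zero    = +-identityʳ 1#
  ^-·1 p (suc m) = trans (×1-homo-* p (p ℕ.^ m)) (*-congˡ (^-·1 p m))

  char∣size : ∀ {p m} → size ≡ p ℕ.^ m → p · 1# ≈ 0#
  char∣size {p} {m} size≡pᵐ = ^≈0⇒≈0 m (begin
    (p · 1#) ^ m    ≈⟨ ^-·1 p m ⟨
    (p ℕ.^ m) · 1#  ≡⟨ ≡.cong (_· 1#) size≡pᵐ ⟨
    size · 1#       ≈⟨ size·1≈0 ⟩
    0#              ∎)

  multiple·≈0 : ∀ {p n} → p · 1# ≈ 0# → ∀ x → p ∣ n → n · x ≈ 0#
  multiple·≈0 {p} p·1≈0 x (divides t ≡.refl) = begin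
    (t ℕ.* p) · x          ≈⟨ ×-congʳ (t ℕ.* p) (*-identityˡ x) ⟨
    (t ℕ.* p) · (1# * x)   ≈⟨ ×-assoc-* (t ℕ.* p) 1# x ⟨
    ((t ℕ.* p) · 1#) * x   ≈⟨ *-congʳ (×1-homo-* t p) ⟩
    (t · 1# * p · 1#) * x  ≈⟨ *-congʳ (*-congˡ p·1≈0) ⟩
    (t · 1# * 0#) * x      ≈⟨ trans (*-congʳ (zeroʳ _)) (zeroˡ x) ⟩
    0#                     ∎

  sum≈last : ∀ n (u : Vector Carrier (suc n)) → (∀ i → toℕ i < n → u i ≈ 0#) → sum u ≈ u (fromℕ n)
  sum≈last zero    u _      = +-identityʳ _
  sum≈last (suc n) u u≈0 = begin
    u Fin.zero + sum (u ∘ Fin.suc)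
      ≈⟨ +-cong (u≈0 Fin.zero (s≤s z≤n)) (sum≈last n (u ∘ Fin.suc) (λ i i<n → u≈0 (Fin.suc i) (s≤s i<n))) ⟩
    0# + u (fromℕ (suc n))           ≈⟨ +-identityˡ _ ⟩
    u (fromℕ (suc n))                ∎

  frobenius : ∀ {p} → Prime p → p · 1# ≈ 0# → ∀ x y → (x + y) ^ p ≈ x ^ p + y ^ p
  frobenius {suc m} p-prime p·1≈0 x y = begin
    (x + y) ^ p                                     ≈⟨ theorem p x y ⟩
    sum (binomialTerm x y p)                        ≈⟨ +-congˡ (sum≈last m _ middle≈0) ⟩
    binomialTerm x y p Fin.zero + binomialTerm x y p (fromℕ p) ≈⟨ +-cong first last ⟩
    y ^ p + x ^ p                                   ≈⟨ +-comm _ _ ⟩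
    x ^ p + y ^ p                                   ∎
    where
    p : ℕ
    p = suc m
    middle≈0 : ∀ (i : Fin p) → toℕ i < m → binomialTerm x y p (Fin.suc i) ≈ 0#
    middle≈0 i i<m = multiple·≈0 p·1≈0 _ (prime∣pCk p-prime (s≤s z≤n) (s≤s i<m))
    first : binomialTerm x y p Fin.zero ≈ y ^ p
    first = trans (+-identityʳ _) (*-identityˡ _)
    last : binomialTerm x y p (fromℕ p) ≈ x ^ p
    last = begin
      (p C toℕ (fromℕ p)) · (x ^ toℕ (fromℕ p) * y ^ (p ℕ.∸ toℕ (fromℕ p)))
        ≡⟨ ≡.cong (λ k → (p C k) · (x ^ k * y ^ (p ℕ.∸ k))) (toℕ-fromℕ p) ⟩
      (p C p) · (x ^ p * y ^ (p ℕ.∸ p))  ≡⟨ ≡.cong₂ (λ a b → a · (x ^ p * y ^ b)) (nCn≡1 p) (ℕ.n∸n≡0 p) ⟩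
      1 · (x ^ p * 1#)                   ≈⟨ trans (+-identityʳ _) (*-identityʳ _) ⟩
      x ^ p                              ∎

  frobenius-^ : ∀ {p} → Prime p → p · 1# ≈ 0# → ∀ j x y → (x + y) ^ (p ℕ.^ j) ≈ x ^ (p ℕ.^ j) + y ^ (p ℕ.^ j)
  frobenius-^ {p} _ _ zero x y = trans (*-identityʳ _) (+-cong (sym (*-identityʳ x)) (sym (*-identityʳ y)))
  frobenius-^ {p} p-prime p·1≈0 (suc j) x y = begin
    (x + y) ^ (p ℕ.* p ℕ.^ j)                  ≈⟨ ^-assocʳ (x + y) p (p ℕ.^ j) ⟨
    ((x + y) ^ p) ^ (p ℕ.^ j)                  ≈⟨ ^-congˡ (p ℕ.^ j) (frobenius p-prime p·1≈0 x y) ⟩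
    (x ^ p + y ^ p) ^ (p ℕ.^ j)                ≈⟨ frobenius-^ p-prime p·1≈0 j (x ^ p) (y ^ p) ⟩
    (x ^ p) ^ (p ℕ.^ j) + (y ^ p) ^ (p ℕ.^ j)  ≈⟨ +-cong (^-assocʳ x p (p ℕ.^ j)) (^-assocʳ y p (p ℕ.^ j)) ⟩
    x ^ (p ℕ.* p ℕ.^ j) + y ^ (p ℕ.* p ℕ.^ j)  ∎

  listProduct : List Carrier → Carrier
  listProduct = foldr _*_ 1#

  listProduct-map-* : ∀ x xs → listProduct (map (x *_) xs) ≈ x ^ length xs * listProduct xs
  listProduct-map-* x []       = sym (*-identityˡ _)
  listProduct-map-* x (y ∷ xs) = begin
    (x * y) * listProduct (map (x *_) xs)          ≈⟨ *-congˡ (listProduct-map-* x xs) ⟩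
    (x * y) * (x ^ length xs * listProduct xs)
      ≈⟨ solve 4 (λ x y a b → (x :* y) :* (a :* b) := (x :* a) :* (y :* b)) refl x y (x ^ length xs) (listProduct xs) ⟩
    (x * x ^ length xs) * (y * listProduct xs)     ∎

  listProduct-nonzero : ∀ {xs} → All (λ y → ¬ y ≈ 0#) xs → ¬ listProduct xs ≈ 0#
  listProduct-nonzero []            = 1≉0
  listProduct-nonzero (y≉0 ∷ xs≉0) = *-nonzero y≉0 (listProduct-nonzero xs≉0)

  nonzero? : Decidable (λ x → ¬ x ≈ 0#)
  nonzero? = ∁? (_≟ 0#)

  size≡1+#nonzero : size ≡ suc (count nonzero?)
  size≡1+#nonzero = ≡.trans (≡.sym (count+count∁≡size (_≟ 0#))) (≡.cong (ℕ._+ count nonzero?) (count-≈ 0#))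

  -- Multiplication by x permutes K^×, so Π y = Π (x y) = x^|K^×| Π y.
  ^-#nonzero≈1 : ∀ {x} → ¬ x ≈ 0# → x ^ count nonzero? ≈ 1#
  ^-#nonzero≈1 {x} x≉0 = *-cancelˡ (listProduct-nonzero (All.all-filter nonzero? elements)) (begin
    listProduct K* * x ^ length K*  ≈⟨ *-comm _ _ ⟩
    x ^ length K* * listProduct K*  ≈⟨ listProduct-map-* x K* ⟨
    listProduct (map (x *_) K*)     ≈⟨ foldr-commMonoid *-isCommutativeMonoid (↭-sym K*↭xK*) ⟩
    listProduct K*                  ≈⟨ *-identityʳ _ ⟨
    listProduct K* * 1#             ∎)
    where
    K* : List Carrier
    K* = counted nonzero?
    nonzero-resp : (λ y → ¬ y ≈ 0#) Respects _≈_
    nonzero-resp y≈z y≉0 z≈0 = y≉0 (trans y≈z z≈0)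
    K*⊆xK* : ∀ {y} → y ∈ K* → y ∈ map (x *_) K*
    K*⊆xK* {y} y∈K* = ∈-resp-≈ setoid (*-cancel-⁻¹ y x≉0) (∈-map⁺ setoid setoid *-congˡ
      (∈-counted⁺ nonzero? nonzero-resp (*-nonzero (∈-counted⁻ nonzero? nonzero-resp y∈K*) (⁻¹-nonzero x≉0))))
    xK*⊆K* : ∀ {y} → y ∈ map (x *_) K* → y ∈ K*
    xK*⊆K* y∈xK* with z , z∈K* , y≈xz ← ∈-map⁻ setoid setoid y∈xK* =
      ∈-counted⁺ nonzero? nonzero-resp (nonzero-resp (sym y≈xz) (*-nonzero x≉0 (∈-counted⁻ nonzero? nonzero-resp z∈K*)))
    K*↭xK* : K* ↭ map (x *_) K*
    K*↭xK* = ↭-unique (counted-unique nonzero?) (map⁺-on (λ _ _ → *-cancelˡ x≉0) (counted-unique nonzero?)) K*⊆xK* xK*⊆K*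

  ^-size : ∀ x → x ^ size ≈ x
  ^-size x with x ≟ 0#
  ... | yes x≈0 = trans (^-congˡ size x≈0) (trans (0^n≈0 (≡.subst (0 <_) (≡.sym size≡1+#nonzero) (s≤s z≤n))) (sym x≈0))
  ... | no x≉0  = begin
    x ^ size                     ≡⟨ ≡.cong (x ^_) size≡1+#nonzero ⟩
    x * x ^ count nonzero?       ≈⟨ *-congˡ (^-#nonzero≈1 x≉0) ⟩
    x * 1#                       ≈⟨ *-identityʳ x ⟩
    x                            ∎

  odd-char⇒2≉0 : ∀ {p} → p · 1# ≈ 0# → ¬ 2 ∣ p → ¬ 1# + 1# ≈ 0#
  odd-char⇒2≉0 p·1≈0 2∤p 2≈0 with r , ≡.refl ← odd⇒≡1+r*2 2∤p = 1≉0 (begin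
    1#                    ≈⟨ +-identityʳ 1# ⟨
    1# + 0#               ≈⟨ +-congˡ [r*2]·1≈0 ⟨
    1# + (r ℕ.* 2) · 1#   ≈⟨ p·1≈0 ⟩
    0#                    ∎)
    where
    [r*2]·1≈0 : (r ℕ.* 2) · 1# ≈ 0#
    [r*2]·1≈0 = trans (×1-homo-* r 2) (trans (*-congˡ (trans (+-congˡ (+-identityʳ 1#)) 2≈0)) (zeroʳ _))

module _ {c ℓ} (K : FiniteField c ℓ) where
  open FiniteField K

  record OddQuadraticExtension (q : ℕ) : Set (c ⊔ ℓ) where
    field
      1<q     : 1 < q
      size≡q² : size ≡ q ℕ.^ 2
      2≉0     : ¬ 1# + 1# ≈ 0#
      ^q-+    : ∀ x y → (x + y) ^ q ≈ x ^ q + y ^ q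

module QuadraticExtension {c ℓ} (K : FiniteField c ℓ) {q : ℕ} (E : OddQuadraticExtension K q) where
  open OddQuadraticExtension E
  open Field K
  open Counting K
  open Characteristic K using (^-size)
  open Polynomials K using (count-roots≤degree; monic-^-x; monic-^+x; geometric; geometric-identity; monic-geometric;
                            rootOfUnity?; #roots-of-unity≤d)
  open Arithmetic using ([1+j]*d≤r+d*j⇒d≤r; m*n≡q*q⇒m≡q)

  σ : Carrier → Carrier
  σ x = x ^ q

  σ-cong : ∀ {x y} → x ≈ y → σ x ≈ σ y
  σ-cong = ^-congˡ q

  σ-* : ∀ x y → σ (x * y) ≈ σ x * σ y
  σ-* x y = ^-distrib-* x y q

  σ-^ : ∀ x n → σ (x ^ n) ≈ σ x ^ n
  σ-^ x n = trans (^-assocʳ x n q) (trans (^-congʳ x (ℕ.*-comm n q)) (sym (^-assocʳ x q n)))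

  σ-0 : σ 0# ≈ 0#
  σ-0 = 0^n≈0 (ℕ.<-trans (s≤s z≤n) 1<q)

  σ-1 : σ 1# ≈ 1#
  σ-1 = 1^n≈1 q

  σ-‿ : ∀ x → σ (- x) ≈ - σ x
  σ-‿ x = inverseʳ-unique (σ x) (σ (- x)) (trans (sym (^q-+ x (- x))) (trans (σ-cong (-‿inverseʳ x)) σ-0))

  σ-- : ∀ x y → σ (x - y) ≈ σ x - σ y
  σ-- x y = trans (^q-+ x (- y)) (+-congˡ (σ-‿ y))

  σ-involutive : ∀ x → σ (σ x) ≈ x
  σ-involutive x = begin
    (x ^ q) ^ q       ≈⟨ ^-assocʳ x q q ⟩
    x ^ (q ℕ.* q)     ≡⟨ ≡.cong (λ k → x ^ (q ℕ.* k)) (ℕ.*-identityʳ q) ⟨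
    x ^ (q ℕ.^ 2)     ≡⟨ ≡.cong (x ^_) size≡q² ⟨
    x ^ size          ≈⟨ ^-size x ⟩
    x                 ∎

  σ-⁻¹ : ∀ {x} → ¬ x ≈ 0# → σ (x ⁻¹) ≈ σ x ⁻¹
  σ-⁻¹ {x} x≉0 = ⁻¹-unique (^-nonzero q x≉0) (trans (sym (σ-* x (x ⁻¹))) (trans (σ-cong (⁻¹-inverseʳ x≉0)) σ-1))

  Fixed : Carrier → Set ℓ
  Fixed = InSubfield K q

  Antifixed : Carrier → Set ℓ
  Antifixed x = σ x ≈ - x

  fixed? : Decidable Fixed
  fixed? x = σ x ≟ x

  antifixed? : Decidable Antifixed
  antifixed? x = σ x ≟ (- x)

  fixed-resp : Fixed Respects _≈_
  fixed-resp x≈y σx≈x = trans (σ-cong (sym x≈y)) (trans σx≈x x≈y)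

  antifixed-resp : Antifixed Respects _≈_
  antifixed-resp x≈y σx≈-x = trans (σ-cong (sym x≈y)) (trans σx≈-x (-‿cong x≈y))

  fixed-+ : ∀ {x y} → Fixed x → Fixed y → Fixed (x + y)
  fixed-+ σx≈x σy≈y = trans (^q-+ _ _) (+-cong σx≈x σy≈y)

  fixed-- : ∀ {x y} → Fixed x → Fixed y → Fixed (x - y)
  fixed-- σx≈x σy≈y = trans (σ-- _ _) (+-cong σx≈x (-‿cong σy≈y))

  fixed-* : ∀ {x y} → Fixed x → Fixed y → Fixed (x * y)
  fixed-* σx≈x σy≈y = trans (σ-* _ _) (*-cong σx≈x σy≈y)

  fixed-^ : ∀ {x} n → Fixed x → Fixed (x ^ n)
  fixed-^ {x} n σx≈x = trans (σ-^ x n) (^-congˡ n σx≈x)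

  fixed-⁻¹ : ∀ {x} → Fixed x → Fixed (x ⁻¹)
  fixed-⁻¹ {x} σx≈x = by-cases (x ≟ 0#)
    where
    by-cases : Dec (x ≈ 0#) → Fixed (x ⁻¹)
    by-cases (yes x≈0) = trans (σ-cong (⁻¹-0 x≈0)) (trans σ-0 (sym (⁻¹-0 x≈0)))
    by-cases (no x≉0)  = trans (σ-⁻¹ x≉0) (⁻¹-cong σx≈x)

  fixed-*-antifixed : ∀ {x y} → Fixed x → Antifixed y → Antifixed (x * y)
  fixed-*-antifixed {x} {y} σx≈x σy≈-y = trans (σ-* _ _) (trans (*-cong σx≈x σy≈-y) (sym (-‿distribʳ-* x y)))

  antifixed-*-antifixed : ∀ {x y} → Antifixed x → Antifixed y → Fixed (x * y)
  antifixed-*-antifixed {x} {y} σx≈-x σy≈-y = trans (σ-* _ _) (trans (*-cong σx≈-x σy≈-y)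
    (solve 2 (λ x y → (:- x) :* (:- y) := x :* y) refl x y))

  antifixed-^-even : ∀ {x} k → Antifixed x → Fixed (x ^ (k ℕ.* 2))
  antifixed-^-even {x} k σx≈-x = trans (σ-^ x (k ℕ.* 2)) (trans (^-congˡ (k ℕ.* 2) σx≈-x) (-‿^-even k x))

  antifixed-⁻¹ : ∀ {x} → Antifixed x → Antifixed (x ⁻¹)
  antifixed-⁻¹ {x} σx≈-x = by-cases (x ≟ 0#)
    where
    by-cases : Dec (x ≈ 0#) → Antifixed (x ⁻¹)
    by-cases (yes x≈0) = trans (σ-cong (⁻¹-0 x≈0)) (trans σ-0 (trans (sym -0#≈0#) (-‿cong (sym (⁻¹-0 x≈0)))))
    by-cases (no x≉0)  = trans (σ-⁻¹ x≉0) (trans (⁻¹-cong σx≈-x) (-‿⁻¹ x≉0))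

  half : Carrier
  half = (1# + 1#) ⁻¹

  fixedPart antifixedPart : Carrier → Carrier
  fixedPart     x = half * (x + σ x)
  antifixedPart x = half * (x - σ x)

  half-fixed : Fixed half
  half-fixed = fixed-⁻¹ (fixed-+ σ-1 σ-1)

  fixedPart-fixed : ∀ x → Fixed (fixedPart x)
  fixedPart-fixed x = begin
    σ (half * (x + σ x))       ≈⟨ σ-* half (x + σ x) ⟩
    σ half * σ (x + σ x)       ≈⟨ *-cong half-fixed (^q-+ x (σ x)) ⟩
    half * (σ x + σ (σ x))     ≈⟨ *-congˡ (trans (+-congˡ (σ-involutive x)) (+-comm _ _)) ⟩
    half * (x + σ x)           ∎

  antifixedPart-antifixed : ∀ x → Antifixed (antifixedPart x)
  antifixedPart-antifixed x = begin
    σ (half * (x - σ x))       ≈⟨ σ-* half (x - σ x) ⟩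
    σ half * σ (x - σ x)       ≈⟨ *-cong half-fixed (σ-- x (σ x)) ⟩
    half * (σ x - σ (σ x))     ≈⟨ *-congˡ (+-congˡ (-‿cong (σ-involutive x))) ⟩
    half * (σ x - x)           ≈⟨ solve 3 (λ h x s → h :* (s :- x) := :- (h :* (x :- s))) refl half x (σ x) ⟩
    - (half * (x - σ x))       ∎

  ≈-fixedPart+antifixedPart : ∀ x → x ≈ fixedPart x + antifixedPart x
  ≈-fixedPart+antifixedPart x = sym (begin
    half * (x + σ x) + half * (x - σ x)
      ≈⟨ solve 3 (λ h x s → h :* (x :+ s) :+ h :* (x :- s) := (h :* (:1 :+ :1)) :* x) refl half x (σ x) ⟩
    (half * (1# + 1#)) * x               ≈⟨ *-congʳ (⁻¹-inverseˡ 2≉0) ⟩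
    1# * x                               ≈⟨ *-identityˡ x ⟩
    x                                    ∎)

  fixed∧antifixed⇒≈0 : ∀ {x} → Fixed x → Antifixed x → x ≈ 0#
  fixed∧antifixed⇒≈0 {x} σx≈x σx≈-x = [ (λ 2≈0 → contradiction 2≈0 2≉0) , id ] (zero-product (begin
    (1# + 1#) * x    ≈⟨ solve 1 (λ x → (:1 :+ :1) :* x := x :- (:- x)) refl x ⟩
    x - - x          ≈⟨ +-congˡ (-‿cong (trans (sym σx≈-x) σx≈x)) ⟩
    x - x            ≈⟨ -‿inverseʳ x ⟩
    0#               ∎))

  fixed+antifixed-injective : ∀ {s s′ v v′} → Fixed s → Fixed s′ → Antifixed v → Antifixed v′ →
                              s + v ≈ s′ + v′ → s ≈ s′ × v ≈ v′
  fixed+antifixed-injective {s} {s′} {v} {v′} σs≈s σs′≈s′ σv≈-v σv′≈-v′ s+v≈s′+v′ =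
    x∙y⁻¹≈ε⇒x≈y s s′ s-s′≈0 , sym (x∙y⁻¹≈ε⇒x≈y v′ v (trans (sym s-s′≈v′-v) s-s′≈0))
    where
    s-s′≈v′-v : s - s′ ≈ v′ - v
    s-s′≈v′-v = begin
      s - s′                ≈⟨ solve 3 (λ s s′ v → s :- s′ := (s :+ v) :- (s′ :+ v)) refl s s′ v ⟩
      (s + v) - (s′ + v)    ≈⟨ +-congʳ s+v≈s′+v′ ⟩
      (s′ + v′) - (s′ + v)  ≈⟨ solve 3 (λ s′ v′ v → (s′ :+ v′) :- (s′ :+ v) := v′ :- v) refl s′ v′ v ⟩
      v′ - v                ∎
    v′-v-antifixed : Antifixed (v′ - v)
    v′-v-antifixed = trans (σ-- v′ v) (trans (+-cong σv′≈-v′ (-‿cong σv≈-v))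
      (solve 2 (λ a b → :- a :- (:- b) := :- (a :- b)) refl v′ v))
    s-s′≈0 : s - s′ ≈ 0#
    s-s′≈0 = fixed∧antifixed⇒≈0 (fixed-- σs≈s σs′≈s′) (antifixed-resp (sym s-s′≈v′-v) v′-v-antifixed)

  module _ {a b t} {A : Pred Carrier a} {B : Pred Carrier b} {T : Pred Carrier t}
           (A? : Decidable A) (B? : Decidable B) (T? : Decidable T)
           (A-resp : A Respects _≈_) (B-resp : B Respects _≈_) (T-resp : T Respects _≈_)
           (A⇒fixed : ∀ {x} → A x → Fixed x) (B⇒antifixed : ∀ {x} → B x → Antifixed x) where

    count-split : (∀ {s v} → A s → B v → T (s + v)) →
                  (∀ {x} → T x → A (fixedPart x) × B (antifixedPart x)) →
                  count T? ≡ count A? ℕ.* count B?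
    count-split A⊕B⇒T T⇒A⊕B = count-⊕ A? B? A-resp B-resp T? T-resp
      (λ As As′ Bv Bv′ → fixed+antifixed-injective (A⇒fixed As) (A⇒fixed As′) (B⇒antifixed Bv) (B⇒antifixed Bv′))
      A⊕B⇒T
      (λ {x} Tx → fixedPart x , antifixedPart x , proj₁ (T⇒A⊕B Tx) , proj₂ (T⇒A⊕B Tx) , ≈-fixedPart+antifixedPart x)

  size≡#fixed*#antifixed : size ≡ count fixed? ℕ.* count antifixed?
  size≡#fixed*#antifixed = ≡.trans (≡.sym (count≡size any? (λ _ → tt)))
    (count-split fixed? antifixed? any? fixed-resp antifixed-resp (λ _ _ → tt) id id
      (λ _ _ → tt) (λ {x} _ → fixedPart-fixed x , antifixedPart-antifixed x))
    where
    any? : Decidable (λ (_ : Carrier) → ⊤)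
    any? _ = yes tt

  #fixed≤q : count fixed? ≤ q
  #fixed≤q = ℕ.≤-trans (ℕ.≤-reflexive (count-cong fixed? (λ x → (x ^ q - x) ≟ 0#) (x≈y⇒x∙y⁻¹≈ε , x∙y⁻¹≈ε⇒x≈y _ _)))
    (count-roots≤degree (monic-^-x 1<q))

  #antifixed≤q : count antifixed? ≤ q
  #antifixed≤q = ℕ.≤-trans (ℕ.≤-reflexive (count-cong antifixed? (λ x → (x ^ q + x) ≟ 0#) (to , from)))
    (count-roots≤degree (monic-^+x 1<q))
    where
    to : ∀ {x} → Antifixed x → x ^ q + x ≈ 0#
    to {x} σx≈-x = trans (+-congʳ σx≈-x) (-‿inverseˡ x)
    from : ∀ {x} → x ^ q + x ≈ 0# → Antifixed x
    from {x} σx+x≈0 = inverseʳ-unique x (σ x) (trans (+-comm x (σ x)) σx+x≈0)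

  #fixed≡q : count fixed? ≡ q
  #fixed≡q = m*n≡q*q⇒m≡q #fixed≤q #antifixed≤q
    (≡.trans (≡.sym size≡#fixed*#antifixed) (≡.trans size≡q² (≡.cong (q ℕ.*_) (ℕ.*-identityʳ q))))

  q≡1+[q∸1] : q ≡ suc (q ℕ.∸ 1)
  q≡1+[q∸1] = ≡.sym (ℕ.m+[n∸m]≡n (ℕ.<⇒≤ 1<q))

  ^[q∸1]≈1⇒fixed : ∀ {t} → t ^ (q ℕ.∸ 1) ≈ 1# → Fixed t
  ^[q∸1]≈1⇒fixed {t} tᵠ⁻¹≈1 = begin
    t ^ q                 ≡⟨ ≡.cong (t ^_) q≡1+[q∸1] ⟩
    t * t ^ (q ℕ.∸ 1)     ≈⟨ *-congˡ tᵠ⁻¹≈1 ⟩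
    t * 1#                ≈⟨ *-identityʳ t ⟩
    t                     ∎

  fixed⇒^[q∸1]≈1 : ∀ {t} → Fixed t → ¬ t ≈ 0# → t ^ (q ℕ.∸ 1) ≈ 1#
  fixed⇒^[q∸1]≈1 {t} σt≈t t≉0 = *-cancelˡ t≉0 (begin
    t * t ^ (q ℕ.∸ 1)     ≡⟨ ≡.cong (t ^_) q≡1+[q∸1] ⟨
    t ^ q                 ≈⟨ σt≈t ⟩
    t                     ≈⟨ *-identityʳ t ⟨
    t * 1#                ∎)

  -- Every t ∈ F^× satisfies 0 = t^(q-1) - 1 = (t^d - 1)·geometric d (1 + j) t where q - 1 = (1 + j) d,
  -- and the second factor has at most d j roots.
  d≤#roots-of-unity : ∀ {d} → 0 < d → d ∣ q ℕ.∸ 1 → d ≤ count (rootOfUnity? d)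
  d≤#roots-of-unity _ (divides zero q∸1≡0) = contradiction q∸1≡0 (ℕ.m>n⇒m∸n≢0 1<q)
  d≤#roots-of-unity {d} 0<d (divides (suc j) q∸1≡[1+j]d) =
    [1+j]*d≤r+d*j⇒d≤r d j _ (ℕ.≤-pred (≡.subst (_≤ 1 ℕ.+ (#roots ℕ.+ d ℕ.* j)) q≡1+[1+j]d q≤1+#roots+dj))
    where
    geometric? : Decidable (λ t → geometric d (suc j) t ≈ 0#)
    geometric? t = geometric d (suc j) t ≟ 0#
    fixed⇒0∨root∨geometric : ∀ {t} → Fixed t → t ≈ 0# ⊎ (t ^ d ≈ 1# ⊎ geometric d (suc j) t ≈ 0#)
    fixed⇒0∨root∨geometric {t} σt≈t with t ≟ 0#
    ... | yes t≈0 = inj₁ t≈0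
    ... | no t≉0 with zero-product (begin
      (t ^ d - 1#) * geometric d (suc j) t  ≈⟨ geometric-identity d (suc j) t ⟩
      t ^ (d ℕ.* suc j) - 1#                ≡⟨ ≡.cong (λ k → t ^ k - 1#) (≡.trans (ℕ.*-comm d (suc j)) (≡.sym q∸1≡[1+j]d)) ⟩
      t ^ (q ℕ.∸ 1) - 1#                    ≈⟨ x≈y⇒x∙y⁻¹≈ε (fixed⇒^[q∸1]≈1 σt≈t t≉0) ⟩
      0#                                    ∎)
    ...   | inj₁ tᵈ-1≈0      = inj₂ (inj₁ (x∙y⁻¹≈ε⇒x≈y _ _ tᵈ-1≈0))
    ...   | inj₂ geometric≈0 = inj₂ (inj₂ geometric≈0)
    q≡1+[1+j]d : q ≡ suc (suc j ℕ.* d)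
    q≡1+[1+j]d = ≡.trans q≡1+[q∸1] (≡.cong suc q∸1≡[1+j]d)
    #roots : ℕ
    #roots = count (rootOfUnity? d)
    q≤1+#roots+dj : q ≤ 1 ℕ.+ (#roots ℕ.+ d ℕ.* j)
    q≤1+#roots+dj = ℕ.≤-trans (ℕ.≤-reflexive (≡.sym #fixed≡q))
      (ℕ.≤-trans (count-∪ fixed? (_≟ 0#) (λ t → rootOfUnity? d t ⊎-dec geometric? t) fixed⇒0∨root∨geometric)
        (ℕ.+-mono-≤ (ℕ.≤-reflexive (count-≈ 0#))
          (ℕ.≤-trans (count-∪ (λ t → rootOfUnity? d t ⊎-dec geometric? t) (rootOfUnity? d) geometric? id)
            (ℕ.+-monoʳ-≤ #roots (count-roots≤degree (monic-geometric 0<d j))))))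

  #roots-of-unity≡d : ∀ {d} → 0 < d → d ∣ q ℕ.∸ 1 → count (rootOfUnity? d) ≡ d
  #roots-of-unity≡d 0<d d∣q∸1 = ℕ.≤-antisym (#roots-of-unity≤d 0<d) (d≤#roots-of-unity 0<d d∣q∸1)

  Solution : ℕ → Carrier → Carrier → Carrier → Set ℓ
  Solution n κ β v = Antifixed v × κ * v ^ n ≈ β

  solution? : ∀ n κ β → Decidable (Solution n κ β)
  solution? n κ β v = antifixed? v ×-dec ((κ * v ^ n) ≟ β)

  solution-resp : ∀ n κ β → Solution n κ β Respects _≈_
  solution-resp n κ β v≈w (σv≈-v , κvⁿ≈β) = antifixed-resp v≈w σv≈-v , trans (*-congˡ (^-congˡ n (sym v≈w))) κvⁿ≈β

  solution-nonzero : ∀ {n κ β v} → 0 < n → ¬ β ≈ 0# → Solution n κ β v → ¬ v ≈ 0#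
  solution-nonzero {n} {κ} {β} {v} 0<n β≉0 (_ , κvⁿ≈β) v≈0 = β≉0 (begin
    β             ≈⟨ κvⁿ≈β ⟨
    κ * v ^ n     ≈⟨ *-congˡ (trans (^-congˡ n v≈0) (0^n≈0 0<n)) ⟩
    κ * 0#        ≈⟨ zeroʳ κ ⟩
    0#            ∎)

  -- Dividing by one solution v₀ maps the solutions onto the t with t^n = 1 that are fixed by σ,
  -- i.e. (Bézout, since t^(q-1) = 1) onto the g-th roots of unity.
  #solutions : ∀ {n κ β} → 0 < n → ¬ κ ≈ 0# → ¬ β ≈ 0# →
               count (solution? n κ β) ≡ 0 ⊎ count (solution? n κ β) ≡ gcd n (q ℕ.∸ 1)
  #solutions {n} {κ} {β} 0<n κ≉0 β≉0 with count≡0⊎∃ (solution? n κ β)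
  ... | inj₁ #≡0 = inj₁ #≡0
  ... | inj₂ (v₀ , v₀-solution@(σv₀≈-v₀ , κv₀ⁿ≈β)) = inj₂ (≡.trans
    (count-image (rootOfUnity? g) (solution? n κ β) root-resp (solution-resp n κ β) (v₀ *_) *-congˡ root⇒solution
      (λ _ _ → *-cancelˡ v₀≉0) solution⇒root)
    (#roots-of-unity≡d gcd-pos (gcd[m,n]∣n n (q ℕ.∸ 1))))
    where
    g : ℕ
    g = gcd n (q ℕ.∸ 1)
    gcd-pos : 0 < g
    gcd-pos = ℕ.n≢0⇒n>0 (gcd[m,n]≢0 n (q ℕ.∸ 1) (inj₁ (ℕ.n>0⇒n≢0 0<n)))
    v₀≉0 : ¬ v₀ ≈ 0#
    v₀≉0 = solution-nonzero 0<n β≉0 v₀-solution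
    root-resp : (λ t → t ^ g ≈ 1#) Respects _≈_
    root-resp t≈u tᵍ≈1 = trans (^-congˡ g (sym t≈u)) tᵍ≈1
    root⇒solution : ∀ {t} → t ^ g ≈ 1# → Solution n κ β (v₀ * t)
    root⇒solution {t} tᵍ≈1 =
      antifixed-resp (*-comm t v₀) (fixed-*-antifixed (^[q∸1]≈1⇒fixed (^-∣ (gcd[m,n]∣n n (q ℕ.∸ 1)) tᵍ≈1)) σv₀≈-v₀) ,
      (begin
        κ * (v₀ * t) ^ n          ≈⟨ *-congˡ (^-distrib-* v₀ t n) ⟩
        κ * (v₀ ^ n * t ^ n)      ≈⟨ *-congˡ (*-congˡ (^-∣ (gcd[m,n]∣m n (q ℕ.∸ 1)) tᵍ≈1)) ⟩
        κ * (v₀ ^ n * 1#)         ≈⟨ *-congˡ (*-identityʳ _) ⟩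
        κ * v₀ ^ n                ≈⟨ κv₀ⁿ≈β ⟩
        β                         ∎)
    solution⇒root : ∀ {v} → Solution n κ β v → ∃ λ t → t ^ g ≈ 1# × v ≈ v₀ * t
    solution⇒root {v} v-solution@(σv≈-v , κvⁿ≈β) =
      v * v₀ ⁻¹ , ^-gcd {m = n} {n = q ℕ.∸ 1} tⁿ≈1 (fixed⇒^[q∸1]≈1 t-fixed t≉0) , sym (*-cancel-⁻¹ v v₀≉0)
      where
      t-fixed : Fixed (v * v₀ ⁻¹)
      t-fixed = antifixed-*-antifixed σv≈-v (antifixed-⁻¹ σv₀≈-v₀)
      t≉0 : ¬ v * v₀ ⁻¹ ≈ 0#
      t≉0 = *-nonzero (solution-nonzero 0<n β≉0 v-solution) (⁻¹-nonzero v₀≉0)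
      tⁿ≈1 : (v * v₀ ⁻¹) ^ n ≈ 1#
      tⁿ≈1 = begin
        (v * v₀ ⁻¹) ^ n           ≈⟨ ^-distrib-* v (v₀ ⁻¹) n ⟩
        v ^ n * v₀ ⁻¹ ^ n         ≈⟨ *-congʳ (*-cancelˡ κ≉0 (trans κvⁿ≈β (sym κv₀ⁿ≈β))) ⟩
        v₀ ^ n * v₀ ⁻¹ ^ n        ≈⟨ ^-distrib-* v₀ (v₀ ⁻¹) n ⟨
        (v₀ * v₀ ⁻¹) ^ n          ≈⟨ ^-congˡ n (⁻¹-inverseʳ v₀≉0) ⟩
        1# ^ n                    ≈⟨ 1^n≈1 n ⟩
        1#                        ∎

  -- n = 2r + 1 is taken in this form so that the exponent n ∸ 1 of paperMap computes to r * 2.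
  module PaperMap (r : ℕ) {a c} (a-fixed : Fixed a) (c-fixed : Fixed c) (δ₂≉0 : ¬ a - c ≈ 0#)
                  {α} (α≉0 : ¬ α ≈ 0#) where

    n : ℕ
    n = suc (r ℕ.* 2)

    f : Carrier → Carrier
    f = paperMap K q n a c

    δ₁ δ₂ κ : Carrier
    δ₁ = a + c
    δ₂ = a - c
    κ  = δ₂ * (1# + 1#) ^ (r ℕ.* 2)

    weight : Carrier → Carrier
    weight v = ((1# + 1#) * v) ^ (r ℕ.* 2)

    f-cong : ∀ {x y} → x ≈ y → f x ≈ f y
    f-cong x≈y = *-cong (+-cong (*-congˡ (σ-cong x≈y)) (*-congˡ x≈y)) (^-congˡ (r ℕ.* 2) (+-cong (σ-cong x≈y) (-‿cong x≈y)))

    f-factorisation : ∀ {s v} → Fixed s → Antifixed v → f (s + v) ≈ (δ₁ * s + δ₂ * v) * weight v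
    f-factorisation {s} {v} σs≈s σv≈-v = begin
      (c * σ (s + v) + a * (s + v)) * (σ (s + v) - (s + v)) ^ (r ℕ.* 2)
        ≈⟨ *-cong (+-congʳ (*-congˡ σ[s+v]≈s-v)) (^-congˡ (r ℕ.* 2) (+-congʳ σ[s+v]≈s-v)) ⟩
      (c * (s - v) + a * (s + v)) * ((s - v) - (s + v)) ^ (r ℕ.* 2)
        ≈⟨ *-cong (solve 4 (λ a c s v → c :* (s :- v) :+ a :* (s :+ v) := (a :+ c) :* s :+ (a :- c) :* v) refl a c s v)
                  (^-congˡ (r ℕ.* 2) (solve 2 (λ s v → (s :- v) :- (s :+ v) := :- ((:1 :+ :1) :* v)) refl s v)) ⟩
      (δ₁ * s + δ₂ * v) * (- ((1# + 1#) * v)) ^ (r ℕ.* 2)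
        ≈⟨ *-congˡ (-‿^-even r ((1# + 1#) * v)) ⟩
      (δ₁ * s + δ₂ * v) * weight v ∎
      where
      σ[s+v]≈s-v : σ (s + v) ≈ s - v
      σ[s+v]≈s-v = trans (^q-+ s v) (+-cong σs≈s σv≈-v)

    δ₂v*weight≈κvⁿ : ∀ v → (δ₂ * v) * weight v ≈ κ * v ^ n
    δ₂v*weight≈κvⁿ v = begin
      (δ₂ * v) * weight v                                      ≈⟨ *-congˡ (^-distrib-* (1# + 1#) v (r ℕ.* 2)) ⟩
      (δ₂ * v) * ((1# + 1#) ^ (r ℕ.* 2) * v ^ (r ℕ.* 2))
        ≈⟨ solve 4 (λ d v t w → (d :* v) :* (t :* w) := (d :* t) :* (v :* w)) refl δ₂ v ((1# + 1#) ^ (r ℕ.* 2)) (v ^ (r ℕ.* 2)) ⟩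
      κ * v ^ n                                                ∎

    f-decomposition : ∀ {s v} → Fixed s → Antifixed v → f (s + v) ≈ (δ₁ * s) * weight v + κ * v ^ n
    f-decomposition {s} {v} σs≈s σv≈-v =
      trans (f-factorisation σs≈s σv≈-v) (trans (distribʳ (weight v) (δ₁ * s) (δ₂ * v)) (+-congˡ (δ₂v*weight≈κvⁿ v)))

    κ≉0 : ¬ κ ≈ 0#
    κ≉0 = *-nonzero δ₂≉0 (^-nonzero (r ℕ.* 2) 2≉0)

    δ₁-fixed : Fixed δ₁
    δ₁-fixed = fixed-+ a-fixed c-fixed

    κ-fixed : Fixed κ
    κ-fixed = fixed-* (fixed-- a-fixed c-fixed) (fixed-^ (r ℕ.* 2) (fixed-+ σ-1 σ-1))

    weight-fixed : ∀ {v} → Antifixed v → Fixed (weight v)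
    weight-fixed σv≈-v = antifixed-^-even r (fixed-*-antifixed (fixed-+ σ-1 σ-1) σv≈-v)

    κvⁿ-antifixed : ∀ {v} → Antifixed v → Antifixed (κ * v ^ n)
    κvⁿ-antifixed {v} σv≈-v = fixed-*-antifixed κ-fixed
      (antifixed-resp (*-comm _ _) (fixed-*-antifixed (antifixed-^-even r σv≈-v) σv≈-v))

    weight-cong : ∀ {v w} → v ≈ w → weight v ≈ weight w
    weight-cong v≈w = ^-congˡ (r ℕ.* 2) (*-congˡ v≈w)

    fibre? : Decidable (λ x → f x ≈ α)
    fibre? x = f x ≟ α

    fibre-resp : (λ x → f x ≈ α) Respects _≈_
    fibre-resp x≈y fx≈α = trans (f-cong (sym x≈y)) fx≈α

    f≈f[split] : ∀ x → f x ≈ f (fixedPart x + antifixedPart x)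
    f≈f[split] x = f-cong (≈-fixedPart+antifixedPart x)

    #fibre≡q*#solutions : δ₁ ≈ 0# → count fibre? ≡ q ℕ.* count (solution? n κ α)
    #fibre≡q*#solutions δ₁≈0 = ≡.trans
      (count-split fixed? (solution? n κ α) fibre? fixed-resp (solution-resp n κ α) fibre-resp id proj₁
        (λ σs≈s (σv≈-v , κvⁿ≈α) → trans (f≈κvⁿ σs≈s σv≈-v) κvⁿ≈α)
        (λ {x} fx≈α → fixedPart-fixed x , antifixedPart-antifixed x ,
          trans (sym (f≈κvⁿ (fixedPart-fixed x) (antifixedPart-antifixed x))) (trans (sym (f≈f[split] x)) fx≈α)))
      (≡.cong (ℕ._* count (solution? n κ α)) #fixed≡q)
      where
      f≈κvⁿ : ∀ {s v} → Fixed s → Antifixed v → f (s + v) ≈ κ * v ^ n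
      f≈κvⁿ {s} {v} σs≈s σv≈-v = begin
        f (s + v)                            ≈⟨ f-decomposition σs≈s σv≈-v ⟩
        (δ₁ * s) * weight v + κ * v ^ n      ≈⟨ +-congʳ (trans (*-congʳ (trans (*-congʳ δ₁≈0) (zeroˡ s))) (zeroˡ _)) ⟩
        0# + κ * v ^ n                       ≈⟨ +-identityˡ _ ⟩
        κ * v ^ n                            ∎

    fiberCount≡#fibre : fiberCount f α ≡ count fibre?
    fiberCount≡#fibre = fiberCount≡count f α

    fiberCount-δ₁≈0 : δ₁ ≈ 0# → fiberCount f α ≡ 0 ⊎ fiberCount f α ≡ q ℕ.* gcd n (q ℕ.∸ 1)
    fiberCount-δ₁≈0 δ₁≈0 = ⊎.map
      (λ #≡0 → ≡.trans #fibre≡q*# (≡.trans (≡.cong (q ℕ.*_) #≡0) (ℕ.*-zeroʳ q)))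
      (λ #≡g → ≡.trans #fibre≡q*# (≡.cong (q ℕ.*_) #≡g))
      (#solutions (s≤s z≤n) κ≉0 α≉0)
      where
      #fibre≡q*# : fiberCount f α ≡ q ℕ.* count (solution? n κ α)
      #fibre≡q*# = ≡.trans fiberCount≡#fibre (#fibre≡q*#solutions δ₁≈0)

    module _ (δ₁≉0 : ¬ δ₁ ≈ 0#) where

      α₁ α₂ : Carrier
      α₁ = fixedPart α
      α₂ = antifixedPart α

      Admissible : Carrier → Set ℓ
      Admissible v = Solution n κ α₂ v × ¬ weight v ≈ 0#

      admissible? : Decidable Admissible
      admissible? v = solution? n κ α₂ v ×-dec ¬? (weight v ≟ 0#)

      admissible-resp : Admissible Respects _≈_
      admissible-resp v≈w (v-solution , weight-v≉0) =
        solution-resp n κ α₂ v≈w v-solution , λ weight-w≈0 → weight-v≉0 (trans (weight-cong v≈w) weight-w≈0)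

      fixedComponent : Carrier → Carrier
      fixedComponent v = α₁ * (δ₁ * weight v) ⁻¹

      preimage : Carrier → Carrier
      preimage v = fixedComponent v + v

      fixedComponent-fixed : ∀ {v} → Antifixed v → Fixed (fixedComponent v)
      fixedComponent-fixed {v} σv≈-v = fixed-* (fixedPart-fixed α) (fixed-⁻¹ (fixed-* δ₁-fixed (weight-fixed σv≈-v)))

      admissible⇒fibre : ∀ {v} → Admissible v → f (preimage v) ≈ α
      admissible⇒fibre {v} ((σv≈-v , κvⁿ≈α₂) , weight-v≉0) = begin
        f (fixedComponent v + v)                               ≈⟨ f-decomposition (fixedComponent-fixed σv≈-v) σv≈-v ⟩
        (δ₁ * (α₁ * (δ₁ * weight v) ⁻¹)) * weight v + κ * v ^ n ≈⟨ +-cong δ₁sw≈α₁ κvⁿ≈α₂ ⟩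
        α₁ + α₂                                                 ≈⟨ ≈-fixedPart+antifixedPart α ⟨
        α                                                       ∎
        where
        δ₁sw≈α₁ : (δ₁ * (α₁ * (δ₁ * weight v) ⁻¹)) * weight v ≈ α₁
        δ₁sw≈α₁ = trans
          (solve 4 (λ d a i w → (d :* (a :* i)) :* w := (d :* w) :* (a :* i)) refl δ₁ α₁ ((δ₁ * weight v) ⁻¹) (weight v))
          (*-cancel-⁻¹ α₁ (*-nonzero δ₁≉0 weight-v≉0))

      preimage-injective : ∀ {v w} → Admissible v → Admissible w → preimage v ≈ preimage w → v ≈ w
      preimage-injective ((σv≈-v , _) , _) ((σw≈-w , _) , _) =
        proj₂ ∘ fixed+antifixed-injective (fixedComponent-fixed σv≈-v) (fixedComponent-fixed σw≈-w) σv≈-v σw≈-w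

      fibre⇒admissible : ∀ {x} → f x ≈ α → ∃ λ v → Admissible v × x ≈ preimage v
      fibre⇒admissible {x} fx≈α = v , ((antifixedPart-antifixed x , κvⁿ≈α₂) , weight-v≉0) ,
        trans (≈-fixedPart+antifixedPart x) (+-congʳ s≈fixedComponent)
        where
        s v : Carrier
        s = fixedPart x
        v = antifixedPart x
        f[s+v]≈α : f (s + v) ≈ α
        f[s+v]≈α = trans (sym (f≈f[split] x)) fx≈α
        components : (δ₁ * s) * weight v ≈ α₁ × κ * v ^ n ≈ α₂
        components = fixed+antifixed-injective
          (fixed-* (fixed-* δ₁-fixed (fixedPart-fixed x)) (weight-fixed (antifixedPart-antifixed x))) (fixedPart-fixed α)
          (κvⁿ-antifixed (antifixedPart-antifixed x)) (antifixedPart-antifixed α)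
          (trans (sym (f-decomposition (fixedPart-fixed x) (antifixedPart-antifixed x)))
                 (trans f[s+v]≈α (≈-fixedPart+antifixedPart α)))
        κvⁿ≈α₂ : κ * v ^ n ≈ α₂
        κvⁿ≈α₂ = proj₂ components
        weight-v≉0 : ¬ weight v ≈ 0#
        weight-v≉0 weight-v≈0 = α≉0 (trans (sym f[s+v]≈α)
          (trans (f-factorisation (fixedPart-fixed x) (antifixedPart-antifixed x)) (trans (*-congˡ weight-v≈0) (zeroʳ _))))
        s≈fixedComponent : s ≈ fixedComponent v
        s≈fixedComponent = *-cancelˡ (*-nonzero δ₁≉0 weight-v≉0) (begin
          (δ₁ * weight v) * s                          ≈⟨ solve 3 (λ d w s → (d :* w) :* s := (d :* s) :* w) refl δ₁ (weight v) s ⟩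
          (δ₁ * s) * weight v                          ≈⟨ proj₁ components ⟩
          α₁                                           ≈⟨ *-cancel-⁻¹ α₁ (*-nonzero δ₁≉0 weight-v≉0) ⟨
          (δ₁ * weight v) * fixedComponent v           ∎)

      #fibre≡#admissible : count fibre? ≡ count admissible?
      #fibre≡#admissible = count-image admissible? fibre? admissible-resp fibre-resp preimage
        (λ v≈w → +-cong (*-congˡ (⁻¹-cong (*-congˡ (weight-cong v≈w)))) v≈w)
        admissible⇒fibre preimage-injective fibre⇒admissible

      admissible⇒≈0 : α₂ ≈ 0# → ∀ {v} → Admissible v → v ≈ 0#
      admissible⇒≈0 α₂≈0 {v} ((_ , κvⁿ≈α₂) , _) = ^≈0⇒≈0 n (*-cancelˡ κ≉0 (trans κvⁿ≈α₂ (trans α₂≈0 (sym (zeroʳ κ)))))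

      -- If α₂ ≈ 0 the only candidate is v = 0, and weight 0# ≉ 0# exactly when n = 1.
      #admissible : count admissible? ≡ 0 ⊎ count admissible? ≡ gcd n (q ℕ.∸ 1)
      #admissible with α₂ ≟ 0# | r ℕ.≟ 0
      ... | yes α₂≈0 | no r≢0 = inj₁ (count≡0 admissible? λ v admissible-v →
        proj₂ admissible-v (trans (weight-cong (admissible⇒≈0 α₂≈0 admissible-v))
          (trans (^-congˡ (r ℕ.* 2) (zeroʳ _)) (0^n≈0 (ℕ.*-monoˡ-< 2 (ℕ.n≢0⇒n>0 r≢0))))))
      ... | yes α₂≈0 | yes ≡.refl = inj₂ (≡.trans (count≡length admissible? admissible-resp ([] ∷ [])
        (λ { (here v≈0) → admissible-resp (sym v≈0) zero-admissible })
        (λ admissible-v → here (admissible⇒≈0 α₂≈0 admissible-v))) (≡.sym (gcd-zeroˡ (q ℕ.∸ 1))))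
        where
        zero-admissible : Admissible 0#
        zero-admissible = (trans σ-0 (sym -0#≈0#) , trans (*-congˡ (0^n≈0 {n} (s≤s z≤n))) (trans (zeroʳ κ) (sym α₂≈0))) , 1≉0
      ... | no α₂≉0 | _ = ⊎.map (≡.trans #admissible≡#solutions) (≡.trans #admissible≡#solutions)
        (#solutions (s≤s z≤n) κ≉0 α₂≉0)
        where
        #admissible≡#solutions : count admissible? ≡ count (solution? n κ α₂)
        #admissible≡#solutions = count-cong admissible? (solution? n κ α₂) (proj₁ , λ v-solution → v-solution ,
          ^-nonzero (r ℕ.* 2) (*-nonzero 2≉0 (solution-nonzero {n} (s≤s z≤n) α₂≉0 v-solution)))

    fiberCount-δ₁≉0 : ¬ δ₁ ≈ 0# → fiberCount f α ≡ 0 ⊎ fiberCount f α ≡ gcd n (q ℕ.∸ 1)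
    fiberCount-δ₁≉0 δ₁≉0 = ⊎.map (≡.trans fiberCount≡#admissible) (≡.trans fiberCount≡#admissible) (#admissible δ₁≉0)
      where
      fiberCount≡#admissible : fiberCount f α ≡ count (admissible? δ₁≉0)
      fiberCount≡#admissible = ≡.trans fiberCount≡#fibre (#fibre≡#admissible δ₁≉0)

open import Data.Nat using (ℕ; _∸_; _≤_; _<_; _^_; _*_)
open import Data.Nat.Divisibility using (_∣_)
open import Data.Nat.Primality using (Prime)
open import Data.Nat.GCD using (gcd)
open import Data.Product using (_×_; ∃)
open import Data.Sum using (_⊎_)
open import Relation.Nullary using (¬_)
open import Relation.Binary.PropositionalEquality using (_≡_)

mainTheorem7 : ∀ {ℓc ℓ} (K : FiniteField ℓc ℓ) (q : ℕ) →
    (∃ λ p → ∃ λ k → Prime p × ¬ (2 ∣ p) × 1 ≤ k × q ≡ p ^ k) →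
    FiniteField.size K ≡ q ^ 2 →
    (n : ℕ) → 1 ≤ n → ¬ (2 ∣ n) →
    (a c : FiniteField.Carrier K) → InSubfield K q a → InSubfield K q c →
    ¬ (FiniteField._≈_ K (FiniteField._-_ K a c) (FiniteField.0# K)) →
    (α : FiniteField.Carrier K) → ¬ (FiniteField._≈_ K α (FiniteField.0# K)) →
    (FiniteField._≈_ K (FiniteField._+_ K a c) (FiniteField.0# K) →
      (FiniteField.fiberCount K (paperMap K q n a c) α ≡ 0)
      ⊎ (FiniteField.fiberCount K (paperMap K q n a c) α ≡ q * gcd n (q ∸ 1)))
    × (¬ (FiniteField._≈_ K (FiniteField._+_ K a c) (FiniteField.0# K)) →
      (FiniteField.fiberCount K (paperMap K q n a c) α ≡ 0)
      ⊎ (FiniteField.fiberCount K (paperMap K q n a c) α ≡ gcd n (q ∸ 1)))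
-- The hypothesis 1 ≤ n is implied by n being odd.
mainTheorem7 K q (p , k , p-prime , 2∤p , 1≤k , ≡.refl) size≡q² n _ 2∤n a c a-fixed c-fixed δ₂≉0 α α≉0
  with r , ≡.refl ← Arithmetic.odd⇒≡1+r*2 2∤n = fiberCount-δ₁≈0 , fiberCount-δ₁≉0
  where
  open Field K using (1#; _≈_; 0#)
  open Characteristic K using (_·_; char∣size; frobenius-^; odd-char⇒2≉0)
  open import Data.Nat.Primality using (prime⇒nonTrivial)
  p·1≈0 : p · 1# ≈ 0#
  p·1≈0 = char∣size {p} {k * 2} (≡.trans size≡q² (ℕ.^-*-assoc p k 2))
  1<p : 1 < p
  1<p = ℕ.nonTrivial⇒n>1 p {{prime⇒nonTrivial p-prime}}
  extension : OddQuadraticExtension K (p ^ k)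
  extension = record
    { 1<q     = ℕ.^-monoʳ-< p 1<p 1≤k
    ; size≡q² = size≡q²
    ; 2≉0     = odd-char⇒2≉0 p·1≈0 2∤p
    ; ^q-+    = frobenius-^ p-prime p·1≈0 k
    }
  open QuadraticExtension.PaperMap K extension r a-fixed c-fixed δ₂≉0 α≉0
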